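{- Let $\mathcal S=(a_i)_{i\ge1}$ be an infinite sequence of elementary foldings that is periodic with even period $k$, i.e. $k$ is even and $a_{i+k}=a_i$ for all $i\ge1$, and let $G=F_{a_1}\circ F_{a_2}\circ\dots\circ F_{a_k}$. Let the seed $\sigma$ be the positive unit triangle $T_0$ with all three sides red if $a_1=+$, and with all three sides blue if $a_1=-$. Then the pattern $P_{\mathcal S}$ is generated by the substitution $G$ with seed $\sigma$: for every $n\ge1$, $G^n(\sigma)$ is an edge coloring of the positive triangle $2^{kn}T_0$ centered at $O$ that coincides with $P_{\mathcal S}$ on all unit edges in the interior of $2^{kn}T_0$.
   Context: Grid: let $\xi_1=(0,-2\sqrt3)$ and let $\xi_2,\xi_3$ be its counterclockwise rotations by $2\pi/3$ and $4\pi/3$. For $i\in\{1,2,3\}$, $n\in\mathbb Z$ put $\ell_{i,n}=\{x\in\mathbb R^2:(x,\xi_i)=3n+1\}$. The union $\mathcal L$ of all $\ell_{i,n}$ is a triangular grid whose smallest triangles (unit triangles) are regular of side $1$; unit edges are the sides of unit triangles. A regular triangle is positive if its vertex opposite its horizontal side lies above that side, negative otherwise. $O$ is the origin and $T_0$ is the positive unit triangle centered at $O$; $\lambda T_0$ denotes the image of $T_0$ under the homothety with center $O$ and ratio $\lambda$. Folding patterns: an elementary folding folds a paper regular triangle of side $2a$ along its three midsegments onto its central triangle of side $a$; it is a folding up ($+$) if all three folds go through the upper half-space of $\mathbb R^3$ and a folding down ($-$) if all go through the lower half-space. When unfolded, fold lines of a folding up become valleys and those of a folding down become peaks. For a finite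 sequence $(a_1,\dots,a_m)$ take the paper triangle $(-2)^mT_0$, perform $a_m$ first (onto $(-2)^{m-1}T_0$), then $a_{m-1}$, …, finally $a_1$ (onto $T_0$), then unfold; valleys are colored red and peaks blue. For an infinite sequence $\mathcal S=(a_i)_{i\ge1}$, $P_{\mathcal S}$ is the red/blue coloring of all unit edges of $\mathcal L$ in which each edge gets its color from the pattern of $(a_1,\dots,a_m)$ for any $m$ with the edge interior to $(-2)^mT_0$. Substitutions: an edge-colored triangle is a regular triangle $\Delta$ of integer side $m$, subdivided into $m^2$ unit triangles by lines parallel to its sides, with each unit edge colored red or blue. For $\epsilon\in\{+,-\}$, the substitution $F_\epsilon$ maps it to the edge-colored triangle $2\Delta$ (homothety of ratio $2$ centered at the center of $\Delta$; same orientation), where each unit triangle $\tau$ of $\Delta$ becomes $2\tau$, subdivided into four unit triangles (three corner ones and one central one of opposite orientation), colored as follows: each unit edge $e$ of $\Delta$ becomes a segment of length $2$ whose two unit edges both get the color opposite to that of $e$; the three interior unit edges of $2\tau$ are colored, for $F_+$, blue if $\tau$ is positive and red if $\tau$ is negative, and, for $F_-$, red if $\tau$ is positive and blue if $\tau$ is negative. -}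

module Defs where

open import Data.Nat as ℕ using (ℕ; zero; suc)
open import Data.Integer as ℤ using (ℤ; +_; _+_; _-_; _*_; -_; _<_; _^_; _/ℕ_; _%ℕ_)
open import Data.Integer.Properties as ℤP using ()
open import Data.Bool using (Bool; true; false; if_then_else_; _∨_; _xor_)
open import Data.Product using (_×_; _,_)
open import Relation.Nullary.Decidable using (does)
open import Function using (id; _∘_)
open import Relation.Binary.PropositionalEquality using (_≡_)

-- elementary foldings: up (+) / down (-)
data Sign : Set where
  plus minus : Sign

data Colour : Set where
  red blue : Colour

opposite : Colour → Colour
opposite red  = blue
opposite blue = red

-- For x ∈ ℝ² put  u_i(x) = ((x , ξ_i) - 1) / 3   (i = 1,2,3).
-- Since ξ₁ + ξ₂ + ξ₃ = 0 we have u₁ + u₂ + u₃ = -1, and the lines of L are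
-- exactly the lines u_i = n (n ∈ ℤ).  The vertices of L are the points with
-- all u_i integral.  A unit edge AB is encoded by the integer triple
--     w = u(A) + u(B)   ( = 2·u(midpoint of AB) ),
-- the "doubled midpoint".  The codes of unit edges are exactly the triples
-- with sum -2 and exactly one even coordinate (the edge lies on the line
-- u_i = w_i / 2 for the even coordinate i).

record P3 : Set where
  constructor ⟨_,_,_⟩
  field
    c₁ c₂ c₃ : ℤ
open P3 public

isEven : ℤ → Bool
isEven z = does (z %ℕ 2 ℕ.≟ 0)

evenCount : P3 → ℕ
evenCount ⟨ a , b , c ⟩ = cnt a ℕ.+ cnt b ℕ.+ cnt c
  where
  cnt : ℤ → ℕ
  cnt z = if isEven z then 1 else 0

IsEdge : P3 → Set
IsEdge w = (c₁ w + c₂ w + c₃ w ≡ - + 2) × (evenCount w ≡ 1)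

-- Homothetic images λT₀ (λ ∈ ℤ, λ ≠ 0); in the code λ is written s.
--
-- T₀ = { x : (x , ξ_i) ≤ 1 for all i }, hence for λ ≠ 0
--   λT₀ = { x : λ·(x , ξ_i) ≤ λ² for all i },
-- and  (x , ξ_i) = 3 u_i(x) + 1.  A unit edge with code w (midpoint u = w/2)
-- is interior to λT₀ iff its midpoint lies in the open triangle, i.e.
--   λ·(3 w_i + 2) < 2 λ²  for i = 1,2,3.
-- (For the triangles considered here, whose sides lie on lines of L, this is
-- the same as: the edge lies in λT₀ and not on its boundary.)

InteriorTo : ℤ → P3 → Set
InteriorTo s w = (s * (+ 3 * c₁ w + + 2) < + 2 * s * s)
               × (s * (+ 3 * c₂ w + + 2) < + 2 * s * s)
               × (s * (+ 3 * c₃ w + + 2) < + 2 * s * s)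

-- For λ ≡ 1 (mod 3) the sides of λT₀ lie on the lines u_i = lineOf λ.
lineOf : ℤ → ℤ
lineOf s = (s - + 1) /ℕ 3

-- The elementary folding number j (j ≥ 1) folds (-2)^j T₀ along its three
-- midsegments onto its central triangle μT₀, μ = (-2)^(j-1).  The
-- midsegments lie on the lines u_i = c with c = lineOf μ, and the corner
-- triangle number i is the part of (-2)^j T₀ with μ·(x , ξ_i) > μ².  The
-- corner i is mapped onto μT₀ by the reflection in the line u_i = c, which in
-- u–coordinates is  u_i ↦ 2c - u_i,  u_j ↦ u_j + (u_i - c)  (j ≠ i),
-- and in doubled coordinates as below.  The central triangle stays fixed.

μ : ℕ → ℤ
μ zero    = + 1
μ (suc j) = (- + 2) ^ j

private
  pos? : ℤ → Bool
  pos? z = does (+ 0 ℤ.<? z)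

  eq? : ℤ → ℤ → Bool
  eq? x y = does (x ℤ.≟ y)

inCorner : ℤ → ℤ → Bool
inCorner m z = pos? (m * (+ 3 * z + + 2) - + 2 * m * m)

reflect₁ reflect₂ reflect₃ : ℤ → P3 → P3
reflect₁ c ⟨ a , b , d ⟩ = ⟨ + 4 * c - a , b + a - + 2 * c , d + a - + 2 * c ⟩
reflect₂ c ⟨ a , b , d ⟩ = ⟨ a + b - + 2 * c , + 4 * c - b , d + b - + 2 * c ⟩
reflect₃ c ⟨ a , b , d ⟩ = ⟨ a + d - + 2 * c , b + d - + 2 * c , + 4 * c - d ⟩

-- the elementary folding number j acting on (the code of) an edge; the
-- Boolean records whether the piece of paper carrying the edge is turned over
foldStep : ℕ → P3 → P3 × Bool
foldStep j w@(⟨ a , b , d ⟩) =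
  if inCorner m a then (reflect₁ c w , true)
  else if inCorner m b then (reflect₂ c w , true)
  else if inCorner m d then (reflect₃ c w , true)
  else (w , false)
  where
  m = μ j
  c = lineOf m

onFoldLine : ℕ → P3 → Bool
onFoldLine j ⟨ a , b , d ⟩ = eq? a (+ 2 * c) ∨ eq? b (+ 2 * c) ∨ eq? d (+ 2 * c)
  where c = lineOf (μ j)

-- colour of a crease made by a folding of sign ε in a layer that is turned
-- over (true) or not (false): a folding up gives valleys (red) on a layer
-- lying face up, peaks (blue) on a layer lying face down; dually for down.
creaseColour : Sign → Bool → Colour
creaseColour plus  false = red
creaseColour plus  true  = blue
creaseColour minus false = blue
creaseColour minus true  = red

-- Pattern of the finite sequence (a₁,…,a_m) on the paper (-2)^m T₀:
-- perform the foldings a_m, a_{m-1}, …, a₁ (in this order), following the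
-- edge; the edge is a crease of the first folding j (in folding order) for
-- which its current position lies on a fold line of that folding, and gets
-- the colour of that crease, taking into account whether its layer has been
-- turned over an odd number of times.  (The final 'red' is never reached for
-- edges interior to (-2)^m T₀.)
-- Sequences are indexed from 1: a : ℕ → Sign, with a 0 unused.
foldPattern : (ℕ → Sign) → ℕ → P3 → Colour
foldPattern a m w = go m w false
  where
  go : ℕ → P3 → Bool → Colour
  go zero    w f = red
  go (suc j) w f with onFoldLine (suc j) w
  ... | true  = creaseColour (a (suc j)) f
  ... | false with foldStep (suc j) w
  ...   | (w' , g) = go j w' (f xor g)

-- A positive regular triangle Δ of side m is given local coordinates
-- d = (d₁,d₂,d₃), d_i = distance (in units of √3/2) of a point from the side
-- of Δ parallel to the lines u_i = const, so that d₁+d₂+d₃ = m; vertices of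
-- the subdivision have d ∈ ℕ³.  A unit edge of Δ with endpoints A,B is again
-- encoded by its doubled midpoint X = d(A) + d(B).  An edge-colored triangle
-- of side m is a colouring of these codes (values at other triples are
-- irrelevant).

Colouring : Set
Colouring = P3 → Colour

-- The homothety of ratio 2 about the centre of Δ maps d ↦ 2d.  In 2Δ, a unit
-- edge with code X is
--  * half of 2e for an edge e = AB of Δ  iff its even coordinate is ≡ 0 mod 4
--    (then X = 3A + B with A = ⌊(X+1)/4⌋ coordinatewise, and e has code
--    A + B = X - 2A);
--  * an interior edge of 2τ for a unit triangle τ of Δ iff its even
--    coordinate is ≡ 2 mod 4; τ is positive (vertices d+e_i) iff its odd
--    coordinates are ≡ 1 mod 4, negative (vertices d-e_i) iff they are ≡ 3.

private
  mod4 : ℤ → ℕ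
  mod4 z = z %ℕ 4

  is0 is1 : ℕ → Bool
  is0 r = does (r ℕ.≟ 0)
  is1 r = does (r ℕ.≟ 1)

halfOfOldEdge : P3 → Bool
halfOfOldEdge ⟨ a , b , d ⟩ = is0 (mod4 a) ∨ is0 (mod4 b) ∨ is0 (mod4 d)

inPositiveτ : P3 → Bool
inPositiveτ ⟨ a , b , d ⟩ = is1 (mod4 a) ∨ is1 (mod4 b) ∨ is1 (mod4 d)

oldEdge : P3 → P3
oldEdge ⟨ a , b , d ⟩ = ⟨ a - + 2 * q a , b - + 2 * q b , d - + 2 * q d ⟩
  where
  q : ℤ → ℤ
  q z = (z + + 1) /ℕ 4

interiorColour : Sign → Bool → Colour
interiorColour plus  true  = blue
interiorColour plus  false = red
interiorColour minus true  = red
interiorColour minus false = blue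

F : Sign → Colouring → Colouring
F ε col X =
  if halfOfOldEdge X then opposite (col (oldEdge X))
  else interiorColour ε (inPositiveτ X)

Gsub : (ℕ → Sign) → ℕ → Colouring → Colouring
Gsub a zero    = id
Gsub a (suc k) = Gsub a k ∘ F (a (suc k))

iterate : ℕ → (Colouring → Colouring) → Colouring → Colouring
iterate zero    g = id
iterate (suc n) g = g ∘ iterate n g

seed : (ℕ → Sign) → Colouring
seed a _ with a 1
... | plus  = red
... | minus = blue

-- Local coordinates of the positive triangle λT₀ (λ > 0, λ ≡ 1 mod 3):
-- it is {u_i ≤ c}, c = lineOf λ, so d_i = c - u_i and an edge code w
-- becomes X_i = 2c - w_i.
toLocal : ℤ → P3 → P3
toLocal s ⟨ a , b , d ⟩ = ⟨ + 2 * c - a , + 2 * c - b , + 2 * c - d ⟩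
  where c = lineOf s

-- Folding number j + 1 reflects the three corners of (-2)ʲ⁺¹T₀ onto (-2)ʲT₀ and leaves
-- the edges strictly inside (-2)ʲT₀ alone, so the pattern of an edge does not depend on
-- how many foldings are performed.  The homothety x ↦ -2x maps the grid onto its coarse
-- subgrid and (-2)ʲT₀ onto (-2)ʲ⁺¹T₀: on a half of a doubled edge, the foldings 2, …, N
-- of (a₁, a₂, …) act exactly as the foldings 1, …, N - 1 of (a₂, a₃, …) act on the edge
-- itself, and, a half being on the same side of every fold line as the whole, the layer
-- gets turned over the same number of times.  Every other edge lies on a fold line of the
-- first folding once the others are done; it becomes a valley or a peak of a₁ according
-- to the orientation of the coarse unit triangle containing it.  These are precisely the
-- two rules of F_{a₁}, so by induction the pattern of (a₁, …, a_N) on (-2)ᴺT₀ is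
-- F_{a₁} ∘ ⋯ ∘ F_{a_N} of any seed, read through x ↦ -x with colours exchanged when N is
-- odd.  For N = kn with k even and (aᵢ) of period k this composition is Gⁿ.

module Submission where

open import Defs

module Patterns where

  open import Data.Nat as ℕ using (ℕ; zero; suc)
  open import Data.Nat.Divisibility using (_∣_; divides)
  import Data.Nat.Properties as ℕP
  import Data.Nat.DivMod as ℕD
  open import Data.Integer as ℤ
    using (ℤ; +_; -[1+_]; +[1+_]; _+_; _-_; _*_; -_; _<_; _≤_; _/ℕ_; _%ℕ_)
  import Data.Integer.Properties as ℤP
  import Data.Integer.DivMod as ℤD
  open import Data.Integer.Tactic.RingSolver using (solve-∀)
  open import Algebra.Properties.AbelianGroup ℤP.+-0-abelianGroup using (∙-cancelʳ)
  open import Data.Bool using (Bool; true; false; not; if_then_else_; _∨_; _xor_)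
  open import Data.Bool.Properties using (xor-identityʳ; not-involutive; ∨-idem; ∨-identityʳ)
  open import Data.Product using (_×_; _,_; proj₁; proj₂; ∃; ∃₂)
  open import Data.Sum using (_⊎_; inj₁; inj₂)
  open import Data.Empty using (⊥-elim)
  open import Function using (_∘_; id)
  open import Relation.Nullary using (¬_; yes; no; contradiction)
  open import Relation.Nullary.Decidable using (does; dec-true; dec-false)
  open import Relation.Binary.PropositionalEquality

  data Signum : Set where
    neg nil pos : Signum

  signum : ℤ → Signum
  signum (+ zero)  = nil
  signum +[1+ _ ] = pos
  signum -[1+ _ ] = neg

  negateˢ : Signum → Signum
  negateˢ neg = pos
  negateˢ nil = nil
  negateˢ pos = neg

  infixl 7 _⊛_
  _⊛_ : Signum → Signum → Signum
  neg ⊛ s = negateˢ s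
  nil ⊛ _ = nil
  pos ⊛ s = s

  isPos isNil : Signum → Bool
  isPos pos = true
  isPos _   = false
  isNil nil = true
  isNil _   = false

  signum-* : ∀ x y → signum (x * y) ≡ signum x ⊛ signum y
  signum-* (+ zero)  y          = refl
  signum-* +[1+ m ] (+ zero)   = cong signum (ℤP.*-zeroʳ +[1+ m ])
  signum-* +[1+ m ] +[1+ n ]  = refl
  signum-* +[1+ m ] -[1+ n ]  = refl
  signum-* -[1+ m ] (+ zero)   = cong signum (ℤP.*-zeroʳ -[1+ m ])
  signum-* -[1+ m ] +[1+ n ]  = refl
  signum-* -[1+ m ] -[1+ n ]  = refl

  signum-neg : ∀ x → signum (- x) ≡ negateˢ (signum x)
  signum-neg (+ zero)  = refl
  signum-neg +[1+ n ] = refl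
  signum-neg -[1+ n ] = refl

  ⊛-negateʳ : ∀ s t → s ⊛ negateˢ t ≡ negateˢ (s ⊛ t)
  ⊛-negateʳ neg neg = refl
  ⊛-negateʳ neg nil = refl
  ⊛-negateʳ neg pos = refl
  ⊛-negateʳ nil t   = refl
  ⊛-negateʳ pos t   = refl

  signum-+-neg : ∀ x y → signum x ≡ neg → signum y ≡ neg → signum (x + y) ≡ neg
  signum-+-neg -[1+ m ] -[1+ n ] _ _  = refl
  signum-+-neg (+ zero)  _         () _
  signum-+-neg +[1+ m ] _         () _
  signum-+-neg -[1+ m ] (+ zero)  _  ()
  signum-+-neg -[1+ m ] +[1+ n ] _  ()

  signum-+-pos : ∀ x y → signum x ≡ pos → signum y ≡ pos → signum (x + y) ≡ pos
  signum-+-pos +[1+ m ] +[1+ n ] _ _  = refl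
  signum-+-pos (+ zero)  _         () _
  signum-+-pos -[1+ m ] _         () _
  signum-+-pos +[1+ m ] (+ zero)  _  ()
  signum-+-pos +[1+ m ] -[1+ n ] _  ()

  ⊛-signum-+-neg : ∀ σ x y → σ ⊛ signum x ≡ neg → σ ⊛ signum y ≡ neg → σ ⊛ signum (x + y) ≡ neg
  ⊛-signum-+-neg pos x y hx hy = signum-+-neg x y hx hy
  ⊛-signum-+-neg neg x y hx hy with signum x in ex | signum y in ey
  ... | pos | pos = cong negateˢ (signum-+-pos x y ex ey)

  signum≡nil⇒≡0 : ∀ x → signum x ≡ nil → x ≡ + 0
  signum≡nil⇒≡0 (+ zero) _ = refl

  does-0<?≡isPos : ∀ x → does (+ 0 ℤ.<? x) ≡ isPos (signum x)
  does-0<?≡isPos (+ zero)  = dec-false (+ 0 ℤ.<? + 0) (ℤP.<-irrefl refl)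
  does-0<?≡isPos +[1+ n ] = dec-true (+ 0 ℤ.<? +[1+ n ]) (ℤ.+<+ ℕ.z<s)
  does-0<?≡isPos -[1+ n ] = dec-false (+ 0 ℤ.<? -[1+ n ]) λ ()

  does-≟≡isNil : ∀ x y → does (x ℤ.≟ y) ≡ isNil (signum (x - y))
  does-≟≡isNil x y with x ℤ.≟ y
  ... | yes refl = cong (λ z → isNil (signum z)) (sym (ℤP.+-inverseʳ x))
  ... | no x≢y with signum (x - y) in e
  ...   | neg = refl
  ...   | pos = refl
  ...   | nil = ⊥-elim (x≢y (ℤP.i-j≡0⇒i≡j x y (signum≡nil⇒≡0 (x - y) e)))

  isNil-⊛ : ∀ s t → s ≢ nil → isNil (s ⊛ t) ≡ isNil t
  isNil-⊛ neg neg _ = refl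
  isNil-⊛ neg nil _ = refl
  isNil-⊛ neg pos _ = refl
  isNil-⊛ nil t s≢nil = ⊥-elim (s≢nil refl)
  isNil-⊛ pos t _ = refl

  ⊛-neg-negateˢ : ∀ s t → (neg ⊛ s) ⊛ negateˢ t ≡ s ⊛ t
  ⊛-neg-negateˢ neg t   = refl
  ⊛-neg-negateˢ nil t   = refl
  ⊛-neg-negateˢ pos neg = refl
  ⊛-neg-negateˢ pos nil = refl
  ⊛-neg-negateˢ pos pos = refl

  signum-neg⇒<0 : ∀ {z} → signum z ≡ neg → z < + 0
  signum-neg⇒<0 { -[1+ n ]} _ = ℤ.-<+
  signum-neg⇒<0 {+ zero} ()
  signum-neg⇒<0 {+[1+ n ]} ()

  <0⇒signum-neg : ∀ {z} → z < + 0 → signum z ≡ neg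
  <0⇒signum-neg { -[1+ n ]} _ = refl
  <0⇒signum-neg {+ n} (ℤ.+<+ ())

  <⇒signum-neg : ∀ {x y} → x < y → signum (x - y) ≡ neg
  <⇒signum-neg {x} {y} x<y =
    <0⇒signum-neg (subst (x - y <_) (ℤP.+-inverseʳ y) (ℤP.+-monoˡ-< (- y) x<y))

  signum-neg⇒< : ∀ {x y} → signum (x - y) ≡ neg → x < y
  signum-neg⇒< {x} {y} s = subst₂ _<_ (l x y) (ℤP.+-identityˡ y) (ℤP.+-monoˡ-< y (signum-neg⇒<0 s))
    where
    l : ∀ x y → x - y + y ≡ x
    l = solve-∀

  quotient-≤ : ∀ d .{{_ : ℕ.NonZero d}} q q′ r r′ → r′ ℕ.< d →
               + r + q * + d ≡ + r′ + q′ * + d → q ≤ q′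
  quotient-≤ d q q′ r r′ r′<d eq =
    subst (q ≤_) (pred-suc q′) (ℤP.i<j⇒i≤pred[j] (ℤP.*-cancelʳ-<-nonNeg {q} {+ 1 + q′} (+ d) qd<))
    where
    open ℤP.≤-Reasoning
    pred-suc : ∀ x → - + 1 + (+ 1 + x) ≡ x
    pred-suc = solve-∀
    suc-* : ∀ x y → y + x * y ≡ (+ 1 + x) * y
    suc-* = solve-∀
    qd< : q * + d < (+ 1 + q′) * + d
    qd< = begin-strict
      q * + d          ≤⟨ ℤP.i≤j+i (q * + d) (+ r) ⟩
      + r + q * + d    ≡⟨ eq ⟩
      + r′ + q′ * + d  <⟨ ℤP.+-monoˡ-< (q′ * + d) (ℤ.+<+ r′<d) ⟩
      + d + q′ * + d   ≡⟨ suc-* q′ (+ d) ⟩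
      (+ 1 + q′) * + d ∎

  [r+q*d]/ℕd≡q : ∀ d .{{_ : ℕ.NonZero d}} q r → r ℕ.< d → (+ r + q * + d) /ℕ d ≡ q
  [r+q*d]/ℕd≡q d q r r<d = ℤP.≤-antisym
    (quotient-≤ d (n /ℕ d) q (n %ℕ d) r r<d (sym division))
    (quotient-≤ d q (n /ℕ d) r (n %ℕ d) (ℤD.n%ℕd<d n d) division)
    where
    n = + r + q * + d
    division : n ≡ + (n %ℕ d) + (n /ℕ d) * + d
    division = ℤD.a≡a%ℕn+[a/ℕn]*n n d

  [r+q*d]%ℕd≡r : ∀ d .{{_ : ℕ.NonZero d}} q r → r ℕ.< d → (+ r + q * + d) %ℕ d ≡ r
  [r+q*d]%ℕd≡r d q r r<d = sym (ℤP.+-injective (∙-cancelʳ (q * + d) _ _ (begin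
      + r + q * + d                  ≡⟨ ℤD.a≡a%ℕn+[a/ℕn]*n n d ⟩
      + (n %ℕ d) + (n /ℕ d) * + d    ≡⟨ cong (λ q′ → + (n %ℕ d) + q′ * + d) ([r+q*d]/ℕd≡q d q r r<d) ⟩
      + (n %ℕ d) + q * + d           ∎)))
    where
    open ≡-Reasoning
    n = + r + q * + d

  data Residue : Set where
    ʳ0 ʳ1 ʳ2 ʳ3 : Residue

  ⟦_⟧ʳ : Residue → ℕ
  ⟦ ʳ0 ⟧ʳ = 0
  ⟦ ʳ1 ⟧ʳ = 1
  ⟦ ʳ2 ⟧ʳ = 2
  ⟦ ʳ3 ⟧ʳ = 3

  residue<4 : ∀ r → ⟦ r ⟧ʳ ℕ.< 4
  residue<4 ʳ0 = ℕ.z<s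
  residue<4 ʳ1 = ℕ.s<s ℕ.z<s
  residue<4 ʳ2 = ℕ.s<s (ℕ.s<s ℕ.z<s)
  residue<4 ʳ3 = ℕ.s<s (ℕ.s<s (ℕ.s<s ℕ.z<s))

  residues-differ : ∀ d .{{_ : ℕ.NonZero d}} q q′ r r′ → r ℕ.< d → r′ ℕ.< d → r ≢ r′ →
                    + r + q * + d ≢ + r′ + q′ * + d
  residues-differ d q q′ r r′ r<d r′<d r≢r′ eq =
    r≢r′ (trans (sym ([r+q*d]%ℕd≡r d q r r<d)) (trans (cong (_%ℕ d) eq) ([r+q*d]%ℕd≡r d q′ r′ r′<d)))

  -- Folding steps

  lineOf-3c+1 : ∀ c → lineOf (+ 3 * c + + 1) ≡ c
  lineOf-3c+1 c = trans (cong (_/ℕ 3) (l c)) ([r+q*d]/ℕd≡q 3 c 0 ℕ.z<s)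
    where
    l : ∀ c → + 3 * c + + 1 - + 1 ≡ + 0 + c * + 3
    l = solve-∀

  foldLine : ℕ → ℤ
  foldLine j = lineOf (μ (suc j))

  μ≡3*foldLine+1 : ∀ j → μ (suc j) ≡ + 3 * foldLine j + + 1
  foldLine-suc : ∀ j → foldLine (suc j) ≡ - + 2 * foldLine j - + 1

  μ-suc : ∀ j → μ (suc (suc j)) ≡ + 3 * (- + 2 * foldLine j - + 1) + + 1
  μ-suc j = trans (cong (- + 2 *_) (μ≡3*foldLine+1 j)) (l (foldLine j))
    where
    l : ∀ c → - + 2 * (+ 3 * c + + 1) ≡ + 3 * (- + 2 * c - + 1) + + 1
    l = solve-∀

  μ≡3*foldLine+1 zero    = refl
  μ≡3*foldLine+1 (suc j) = trans (μ-suc j) (cong (λ c → + 3 * c + + 1) (sym (foldLine-suc j)))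

  foldLine-suc j = trans (cong lineOf (μ-suc j)) (lineOf-3c+1 (- + 2 * foldLine j - + 1))

  signum-μ≢nil : ∀ j → signum (μ (suc j)) ≢ nil
  signum-μ≢nil zero    ()
  signum-μ≢nil (suc j) e =
    signum-μ≢nil j (negateˢ≡nil (trans (sym (signum-* (- + 2) (μ (suc j)))) e))
    where
    negateˢ≡nil : ∀ {s} → negateˢ s ≡ nil → s ≡ nil
    negateˢ≡nil {nil} _ = refl

  P3-ext : ∀ {w w′} → c₁ w ≡ c₁ w′ → c₂ w ≡ c₂ w′ → c₃ w ≡ c₃ w′ → w ≡ w′
  P3-ext refl refl refl = refl

  Balanced : P3 → Set
  Balanced w = c₁ w + c₂ w + c₃ w ≡ - + 2

  rotate-sum : ∀ x y z → x + y + z ≡ - + 2 → y + z + x ≡ - + 2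
  rotate-sum x y z sum = trans (l x y z) sum
    where
    l : ∀ x y z → y + z + x ≡ x + y + z
    l = solve-∀

  -- InteriorTo s w and inCorner s z compare excess s (cᵢ w) and excess s z with 0.
  excess : ℤ → ℤ → ℤ
  excess s z = s * (+ 3 * z + + 2) - + 2 * s * s

  data Axis : Set where
    axis₁ axis₂ axis₃ : Axis

  coord : Axis → P3 → ℤ
  coord axis₁ = c₁
  coord axis₂ = c₂
  coord axis₃ = c₃

  reflect : Axis → ℤ → P3 → P3
  reflect axis₁ = reflect₁
  reflect axis₂ = reflect₂
  reflect axis₃ = reflect₃

  reflect-balanced : ∀ i c w → Balanced w → Balanced (reflect i c w)
  reflect-balanced axis₁ c w b = trans (l c (c₁ w) (c₂ w) (c₃ w)) b
    where
    l : ∀ c x y z → (+ 4 * c - x) + (y + x - + 2 * c) + (z + x - + 2 * c) ≡ x + y + z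
    l = solve-∀
  reflect-balanced axis₂ c w b = trans (l c (c₁ w) (c₂ w) (c₃ w)) b
    where
    l : ∀ c x y z → (x + y - + 2 * c) + (+ 4 * c - y) + (z + y - + 2 * c) ≡ x + y + z
    l = solve-∀
  reflect-balanced axis₃ c w b = trans (l c (c₁ w) (c₂ w) (c₃ w)) b
    where
    l : ∀ c x y z → (x + z - + 2 * c) + (y + z - + 2 * c) + (+ 4 * c - z) ≡ x + y + z
    l = solve-∀

  reflect₁-involutive : ∀ c w → reflect₁ c (reflect₁ c w) ≡ w
  reflect₁-involutive c ⟨ x , y , z ⟩ = P3-ext (l₁ c x) (l₂ c x y) (l₂ c x z)
    where
    l₁ : ∀ c x → + 4 * c - (+ 4 * c - x) ≡ x
    l₁ = solve-∀
    l₂ : ∀ c x y → y + x - + 2 * c + (+ 4 * c - x) - + 2 * c ≡ y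
    l₂ = solve-∀

  excess-paper-3c+1 : ∀ c x y z → x + y + z ≡ - + 2 →
    excess (- + 2 * (+ 3 * c + + 1)) x ≡ + 6 * ((+ 3 * c + + 1) * ((y - + 2 * c) + (z - + 2 * c)))
  excess-paper-3c+1 c x y z sum = trans (cong (excess (- + 2 * (+ 3 * c + + 1))) x≡) (l c y z)
    where
    x≡ : x ≡ - + 2 - y - z
    x≡ = trans (l′ x y z) (cong (λ s → s - y - z) sum)
      where
      l′ : ∀ x y z → x ≡ x + y + z - y - z
      l′ = solve-∀
    l : ∀ c y z → let m = - + 2 * (+ 3 * c + + 1) in
        m * (+ 3 * (- + 2 - y - z) + + 2) - + 2 * m * m ≡ + 6 * ((+ 3 * c + + 1) * ((y - + 2 * c) + (z - + 2 * c)))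
    l = solve-∀

  onLineAt : ℤ → P3 → Bool
  onLineAt c w = does (c₁ w ℤ.≟ + 2 * c) ∨ does (c₂ w ℤ.≟ + 2 * c) ∨ does (c₃ w ℤ.≟ + 2 * c)

  -- One folding: the paper -2m T₀ is folded onto m T₀ along the lines u_i = c.
  module Level (m c : ℤ) (m≡3c+1 : m ≡ + 3 * c + + 1) (m≢0 : signum m ≢ nil) where

    offset : ℤ → ℤ
    offset x = x - + 2 * c

    -- pos: on the corner side of the fold line u = c, nil: on it, neg: on the side of m T₀
    side : ℤ → Signum
    side x = signum m ⊛ signum (offset x)

    pairSide : ℤ → ℤ → Signum
    pairSide y z = signum m ⊛ signum (offset y + offset z)

    InCentral : P3 → Set
    InCentral w = (side (c₁ w) ≡ neg) × (side (c₂ w) ≡ neg) × (side (c₃ w) ≡ neg)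

    InPaper : P3 → Set
    InPaper w = (pairSide (c₂ w) (c₃ w) ≡ neg) × (pairSide (c₃ w) (c₁ w) ≡ neg)
              × (pairSide (c₁ w) (c₂ w) ≡ neg)

    onLine : P3 → Bool
    onLine = onLineAt c

    stepByCorners : Bool → Bool → Bool → P3 → P3 × Bool
    stepByCorners b₁ b₂ b₃ w =
      if b₁ then (reflect₁ c w , true)
      else if b₂ then (reflect₂ c w , true)
      else if b₃ then (reflect₃ c w , true)
      else (w , false)

    step : P3 → P3 × Bool
    step w = stepByCorners (inCorner m (c₁ w)) (inCorner m (c₂ w)) (inCorner m (c₃ w)) w

    excess≡ : ∀ x → excess m x ≡ + 3 * (m * offset x)
    excess≡ x rewrite m≡3c+1 = l c x
      where
      l : ∀ c x → let m = + 3 * c + + 1 in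
          m * (+ 3 * x + + 2) - + 2 * m * m ≡ + 3 * (m * (x - + 2 * c))
      l = solve-∀

    signum-excess : ∀ x → signum (excess m x) ≡ side x
    signum-excess x = begin
      signum (excess m x)            ≡⟨ cong signum (excess≡ x) ⟩
      signum (+ 3 * (m * offset x))  ≡⟨ signum-* (+ 3) (m * offset x) ⟩
      signum (m * offset x)          ≡⟨ signum-* m (offset x) ⟩
      side x                         ∎
      where open ≡-Reasoning

    excess-paper≡ : ∀ x y z → x + y + z ≡ - + 2 → excess (- + 2 * m) x ≡ + 6 * (m * (offset y + offset z))
    excess-paper≡ x y z sum rewrite m≡3c+1 = excess-paper-3c+1 c x y z sum

    signum-excess-paper : ∀ x y z → x + y + z ≡ - + 2 → signum (excess (- + 2 * m) x) ≡ pairSide y z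
    signum-excess-paper x y z sum = begin
      signum (excess (- + 2 * m) x)                  ≡⟨ cong signum (excess-paper≡ x y z sum) ⟩
      signum (+ 6 * (m * (offset y + offset z)))     ≡⟨ signum-* (+ 6) _ ⟩
      signum (m * (offset y + offset z))             ≡⟨ signum-* m _ ⟩
      pairSide y z                                   ∎
      where open ≡-Reasoning

    inCorner≡ : ∀ x → inCorner m x ≡ isPos (side x)
    inCorner≡ x = trans (does-0<?≡isPos (excess m x)) (cong isPos (signum-excess x))

    onLine-coordinate : ∀ x → does (x ℤ.≟ + 2 * c) ≡ isNil (side x)
    onLine-coordinate x = trans (does-≟≡isNil x (+ 2 * c)) (sym (isNil-⊛ (signum m) _ m≢0))

    onLine≡ : ∀ w → onLine w ≡ (isNil (side (c₁ w)) ∨ isNil (side (c₂ w)) ∨ isNil (side (c₃ w)))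
    onLine≡ w rewrite onLine-coordinate (c₁ w) | onLine-coordinate (c₂ w)
                    | onLine-coordinate (c₃ w) = refl

    step≡ : ∀ w → step w ≡ stepByCorners (isPos (side (c₁ w))) (isPos (side (c₂ w))) (isPos (side (c₃ w))) w
    step≡ w rewrite inCorner≡ (c₁ w) | inCorner≡ (c₂ w) | inCorner≡ (c₃ w) = refl

    step-by-sides : ∀ w s₁ s₂ s₃ → side (c₁ w) ≡ s₁ → side (c₂ w) ≡ s₂ → side (c₃ w) ≡ s₃ →
             step w ≡ stepByCorners (isPos s₁) (isPos s₂) (isPos s₃) w
    step-by-sides w _ _ _ refl refl refl = step≡ w

    data FoldCase (w : P3) : Set where
      stays      : step w ≡ (w , false) → InCentral w → FoldCase w
      reflected : ∀ i → step w ≡ (reflect i c w , true) → side (coord i w) ≡ pos → FoldCase w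

    foldCase : ∀ w → onLine w ≡ false → FoldCase w
    foldCase w off with side (c₁ w) in e₁ | side (c₂ w) in e₂ | side (c₃ w) in e₃
                      | step≡ w | onLine≡ w
    ... | pos | _   | _   | st | _  = reflected axis₁ st e₁
    ... | neg | pos | _   | st | _  = reflected axis₂ st e₂
    ... | neg | neg | pos | st | _  = reflected axis₃ st e₃
    ... | neg | neg | neg | st | _  = stays st (e₁ , e₂ , e₃)
    ... | nil | _   | _   | _  | on = contradiction (trans (sym on) off) λ ()
    ... | neg | nil | _   | _  | on = contradiction (trans (sym on) off) λ ()
    ... | neg | neg | nil | _  | on = contradiction (trans (sym on) off) λ ()

    interior⇒inCentral : ∀ w → InteriorTo m w → InCentral w
    interior⇒inCentral w (i₁ , i₂ , i₃) = side-neg (c₁ w) i₁ , side-neg (c₂ w) i₂ , side-neg (c₃ w) i₃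
      where
      side-neg : ∀ x → m * (+ 3 * x + + 2) < + 2 * m * m → side x ≡ neg
      side-neg x i = trans (sym (signum-excess x)) (<⇒signum-neg i)

    inCentral⇒interior : ∀ w → InCentral w → InteriorTo m w
    inCentral⇒interior w (s₁ , s₂ , s₃) = below (c₁ w) s₁ , below (c₂ w) s₂ , below (c₃ w) s₃
      where
      below : ∀ x → side x ≡ neg → m * (+ 3 * x + + 2) < + 2 * m * m
      below x s = signum-neg⇒< (trans (signum-excess x) s)

    interior⇒inPaper : ∀ w → Balanced w → InteriorTo (- + 2 * m) w → InPaper w
    interior⇒inPaper w sum (i₁ , i₂ , i₃) =
      trans (sym (signum-excess-paper x y z sum)) (<⇒signum-neg i₁) ,
      trans (sym (signum-excess-paper y z x (rotate-sum x y z sum))) (<⇒signum-neg i₂) ,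
      trans (sym (signum-excess-paper z x y (rotate-sum y z x (rotate-sum x y z sum)))) (<⇒signum-neg i₃)
      where
      x = c₁ w
      y = c₂ w
      z = c₃ w

    inPaper⇒interior : ∀ w → Balanced w → InPaper w → InteriorTo (- + 2 * m) w
    inPaper⇒interior w sum (o₁ , o₂ , o₃) =
      signum-neg⇒< (trans (signum-excess-paper x y z sum) o₁) ,
      signum-neg⇒< (trans (signum-excess-paper y z x (rotate-sum x y z sum)) o₂) ,
      signum-neg⇒< (trans (signum-excess-paper z x y (rotate-sum y z x (rotate-sum x y z sum))) o₃)
      where
      x = c₁ w
      y = c₂ w
      z = c₃ w

    inCentral⇒inPaper : ∀ w → InCentral w → InPaper w
    inCentral⇒inPaper w (s₁ , s₂ , s₃) =
      ⊛-signum-+-neg (signum m) _ _ s₂ s₃ , ⊛-signum-+-neg (signum m) _ _ s₃ s₁ ,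
      ⊛-signum-+-neg (signum m) _ _ s₁ s₂

    side-reflect-own : ∀ x → side (+ 4 * c - x) ≡ negateˢ (side x)
    side-reflect-own x = begin
      signum m ⊛ signum (offset (+ 4 * c - x))  ≡⟨ cong (λ y → signum m ⊛ signum y) (l c x) ⟩
      signum m ⊛ signum (- offset x)            ≡⟨ cong (signum m ⊛_) (signum-neg (offset x)) ⟩
      signum m ⊛ negateˢ (signum (offset x))    ≡⟨ ⊛-negateʳ (signum m) _ ⟩
      negateˢ (side x)                          ∎
      where
      open ≡-Reasoning
      l : ∀ c x → + 4 * c - x - + 2 * c ≡ - (x - + 2 * c)
      l = solve-∀

    side-reflect-other : ∀ y x → side (y + x - + 2 * c) ≡ pairSide y x
    side-reflect-other y x = cong (λ z → signum m ⊛ signum z) (l c y x)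
      where
      l : ∀ c y x → y + x - + 2 * c - + 2 * c ≡ (y - + 2 * c) + (x - + 2 * c)
      l = solve-∀

    pairSide-comm : ∀ y z → pairSide y z ≡ pairSide z y
    pairSide-comm y z = cong (λ s → signum m ⊛ signum s) (ℤP.+-comm (offset y) (offset z))

    reflect-inCentral : ∀ i w → side (coord i w) ≡ pos → InPaper w → InCentral (reflect i c w)
    reflect-inCentral axis₁ w s (o₁ , o₂ , o₃) =
      trans (side-reflect-own (c₁ w)) (cong negateˢ s) ,
      trans (side-reflect-other (c₂ w) (c₁ w)) (trans (pairSide-comm (c₂ w) (c₁ w)) o₃) ,
      trans (side-reflect-other (c₃ w) (c₁ w)) o₂
    reflect-inCentral axis₂ w s (o₁ , o₂ , o₃) =
      trans (side-reflect-other (c₁ w) (c₂ w)) o₃ ,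
      trans (side-reflect-own (c₂ w)) (cong negateˢ s) ,
      trans (side-reflect-other (c₃ w) (c₂ w)) (trans (pairSide-comm (c₃ w) (c₂ w)) o₁)
    reflect-inCentral axis₃ w s (o₁ , o₂ , o₃) =
      trans (side-reflect-other (c₁ w) (c₃ w)) (trans (pairSide-comm (c₁ w) (c₃ w)) o₂) ,
      trans (side-reflect-other (c₂ w) (c₃ w)) o₁ ,
      trans (side-reflect-own (c₃ w)) (cong negateˢ s)

    step-into-interior : ∀ w {w′ g} → step w ≡ (w′ , g) → Balanced w → InteriorTo (- + 2 * m) w →
                         onLine w ≡ false → InteriorTo m w′ × Balanced w′
    step-into-interior w {w′} st′ sum int off = landing (foldCase w off) (interior⇒inPaper w sum int)
      where
      lands-at : ∀ {v h} → step w ≡ (v , h) → InteriorTo m v × Balanced v → InteriorTo m w′ × Balanced w′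
      lands-at st = subst (λ v → InteriorTo m v × Balanced v) (cong proj₁ (trans (sym st) st′))
      landing : FoldCase w → InPaper w → InteriorTo m w′ × Balanced w′
      landing (stays st ins) _ = lands-at st (inCentral⇒interior w ins , sum)
      landing (reflected i st s) out =
        lands-at st (inCentral⇒interior (reflect i c w) (reflect-inCentral i w s out) , reflect-balanced i c w sum)

    reflect₁-preimage : ∀ {w} → Balanced w → InCentral w →
      let w′ = reflect₁ c w in
      Balanced w′ × InteriorTo (- + 2 * m) w′ × onLine w′ ≡ false × step w′ ≡ (w , true)
    reflect₁-preimage {w} sum (s₁ , s₂ , s₃) =
      sum′ , inPaper⇒interior w′ sum′ (o₁ , o₂ , o₃) , off , on-step
      where
      w′ = reflect₁ c w
      sum′ : Balanced w′
      sum′ = reflect-balanced axis₁ c w sum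
      t₁ : side (c₁ w′) ≡ pos
      t₁ = trans (side-reflect-own (c₁ w)) (cong negateˢ s₁)
      t₂ : side (c₂ w′) ≡ neg
      t₂ = trans (side-reflect-other (c₂ w) (c₁ w)) (⊛-signum-+-neg (signum m) _ _ s₂ s₁)
      t₃ : side (c₃ w′) ≡ neg
      t₃ = trans (side-reflect-other (c₃ w) (c₁ w)) (⊛-signum-+-neg (signum m) _ _ s₃ s₁)
      off : onLine w′ ≡ false
      off rewrite onLine≡ w′ | t₁ | t₂ | t₃ = refl
      on-step : step w′ ≡ (w , true)
      on-step rewrite step≡ w′ | t₁ = cong (_, true) (reflect₁-involutive c w)
      o₁ : pairSide (c₂ w′) (c₃ w′) ≡ neg
      o₁ = ⊛-signum-+-neg (signum m) _ _ t₂ t₃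
      o₂ : pairSide (c₃ w′) (c₁ w′) ≡ neg
      o₂ = trans (cong (λ z → signum m ⊛ signum z) (l c (c₁ w) (c₃ w))) s₃
        where
        l : ∀ c x z → (z + x - + 2 * c - + 2 * c) + (+ 4 * c - x - + 2 * c) ≡ z - + 2 * c
        l = solve-∀
      o₃ : pairSide (c₁ w′) (c₂ w′) ≡ neg
      o₃ = trans (cong (λ z → signum m ⊛ signum z) (l c (c₁ w) (c₂ w))) s₂
        where
        l : ∀ c x y → (+ 4 * c - x - + 2 * c) + (y + x - + 2 * c - + 2 * c) ≡ y - + 2 * c
        l = solve-∀

    inCentral⇒fixed : ∀ w → InCentral w → onLine w ≡ false × step w ≡ (w , false)
    inCentral⇒fixed w (s₁ , s₂ , s₃) = off , fixed
      where
      off : onLine w ≡ false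
      off rewrite onLine≡ w | s₁ | s₂ | s₃ = refl
      fixed : step w ≡ (w , false)
      fixed rewrite step≡ w | s₁ | s₂ | s₃ = refl

  -- folding number j + 1, which folds (-2)ʲ⁺¹ T₀ onto (-2)ʲ T₀
  module At (j : ℕ) = Level (μ (suc j)) (foldLine j) (μ≡3*foldLine+1 j) (signum-μ≢nil j)

  -- Folding patterns

  foldColour : (ℕ → Sign) → ℕ → P3 → Bool → Colour
  foldColour a zero    w f = red
  foldColour a (suc j) w f =
    if onFoldLine (suc j) w then creaseColour (a (suc j)) f
    else foldColour a j (proj₁ (foldStep (suc j) w)) (f xor proj₂ (foldStep (suc j) w))

  module _ (a : ℕ → Sign) (j : ℕ) where

    foldColour-crease : ∀ w {f} → onFoldLine (suc j) w ≡ true →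
                        foldColour a (suc j) w f ≡ creaseColour (a (suc j)) f
    foldColour-crease w on rewrite on = refl

    foldColour-step : ∀ w {w′ f g} → onFoldLine (suc j) w ≡ false → foldStep (suc j) w ≡ (w′ , g) →
                      foldColour a (suc j) w f ≡ foldColour a j w′ (f xor g)
    foldColour-step w off st rewrite off | st = refl

    foldPattern-crease : ∀ w → onFoldLine (suc j) w ≡ true →
                         foldPattern a (suc j) w ≡ creaseColour (a (suc j)) false
    foldPattern-crease w on rewrite on = refl

    foldPattern-stay : ∀ w {w′} → onFoldLine (suc j) w ≡ false → foldStep (suc j) w ≡ (w′ , false) →
                       foldPattern a (suc j) w ≡ foldPattern a j w′
    foldPattern-stay w off st rewrite off | st = refl

    module _ (W w : P3) (off : onFoldLine (suc (suc j)) W ≡ false)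
                   (turn : foldStep (suc (suc j)) W ≡ (w , true)) where

      turned-crease : onFoldLine (suc j) w ≡ true →
                      foldPattern a (suc (suc j)) W ≡ creaseColour (a (suc j)) true
      turned-crease on rewrite off | turn | on = refl

      turned-turn : ∀ {w′} → onFoldLine (suc j) w ≡ false → foldStep (suc j) w ≡ (w′ , true) →
                    foldPattern a (suc (suc j)) W ≡ foldPattern a j w′
      turned-turn off′ st rewrite off | turn | off′ | st = refl

      turned-stay : ∀ {W′} → onFoldLine (suc j) w ≡ false → foldStep (suc j) w ≡ (w , false) →
                    onFoldLine (suc j) W′ ≡ false → foldStep (suc j) W′ ≡ (w , true) →
                    foldPattern a (suc (suc j)) W ≡ foldPattern a (suc j) W′
      turned-stay off′ st off″ turn′ rewrite off | turn | off′ | st | off″ | turn′ = refl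

  foldPattern-1-offLine : ∀ a W → onFoldLine 1 W ≡ false → foldPattern a 1 W ≡ red
  foldPattern-1-offLine a W off rewrite off = refl

  -- A turned-over layer carrying w is realised, for foldPattern, by the mirror image of w
  -- in the first corner (reflect₁-preimage), hence the mutual recursion.
  foldPattern≡foldColour : ∀ a j w → Balanced w → InteriorTo (μ (suc j)) w →
                           foldPattern a j w ≡ foldColour a j w false
  foldPattern-turned : ∀ a j W w → Balanced W → InteriorTo (μ (suc (suc j))) W →
                       onFoldLine (suc j) W ≡ false → foldStep (suc j) W ≡ (w , true) →
                       foldPattern a (suc j) W ≡ foldColour a j w true

  foldPattern≡foldColour a zero    w _   _   = refl
  foldPattern≡foldColour a (suc j) w sum int = by-line (onFoldLine (suc j) w) refl
    where
    open ≡-Reasoning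
    turned : ∀ {w′} → onFoldLine (suc j) w ≡ false → foldStep (suc j) w ≡ (w′ , true) →
             foldPattern a (suc j) w ≡ foldColour a (suc j) w false
    turned line st = trans (foldPattern-turned a j w _ sum int line st) (sym (foldColour-step a j w line st))
    by-case : onFoldLine (suc j) w ≡ false → At.FoldCase j w →
              foldPattern a (suc j) w ≡ foldColour a (suc j) w false
    by-case line (At.stays st ins) = begin
      foldPattern a (suc j) w      ≡⟨ foldPattern-stay a j w line st ⟩
      foldPattern a j w            ≡⟨ foldPattern≡foldColour a j w sum (At.inCentral⇒interior j w ins) ⟩
      foldColour a j w false       ≡⟨ foldColour-step a j w line st ⟨
      foldColour a (suc j) w false ∎
    by-case line (At.reflected _ st _) = turned line st
    by-line : ∀ b → onFoldLine (suc j) w ≡ b → foldPattern a (suc j) w ≡ foldColour a (suc j) w false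
    by-line true  line = trans (foldPattern-crease a j w line) (sym (foldColour-crease a j w line))
    by-line false line = by-case line (At.foldCase j w line)

  foldPattern-turned a zero    W w _ _ off _ = foldPattern-1-offLine a W off
  foldPattern-turned a (suc j) W w sum int off turn = by-line (onFoldLine (suc j) w) refl
    where
    open ≡-Reasoning
    reached : InteriorTo (μ (suc (suc j))) w × Balanced w
    reached = At.step-into-interior (suc j) W turn sum int off
    turned : ∀ {w′} → onFoldLine (suc j) w ≡ false → foldStep (suc j) w ≡ (w′ , true) →
             foldPattern a (suc (suc j)) W ≡ foldColour a (suc j) w true
    turned {w′} line st = begin
      foldPattern a (suc (suc j)) W  ≡⟨ turned-turn a j W w off turn line st ⟩
      foldPattern a j w′             ≡⟨ foldPattern≡foldColour a j w′ (proj₂ reached′) (proj₁ reached′) ⟩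
      foldColour a j w′ false        ≡⟨ foldColour-step a j w line st ⟨
      foldColour a (suc j) w true    ∎
      where
      reached′ : InteriorTo (μ (suc j)) w′ × Balanced w′
      reached′ = At.step-into-interior j w st (proj₂ reached) (proj₁ reached) line
    by-case : onFoldLine (suc j) w ≡ false → At.FoldCase j w →
              foldPattern a (suc (suc j)) W ≡ foldColour a (suc j) w true
    by-case line (At.stays st ins) = begin
      foldPattern a (suc (suc j)) W  ≡⟨ turned-stay a j W w off turn line st off′ turn′ ⟩
      foldPattern a (suc j) W′       ≡⟨ foldPattern-turned a j W′ w sum′ int′ off′ turn′ ⟩
      foldColour a j w true          ≡⟨ foldColour-step a j w line st ⟨
      foldColour a (suc j) w true    ∎
      where
      W′ = reflect₁ (foldLine j) w
      pre = At.reflect₁-preimage j (proj₂ reached) ins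
      sum′ : Balanced W′
      sum′ = proj₁ pre
      int′ : InteriorTo (μ (suc (suc j))) W′
      int′ = proj₁ (proj₂ pre)
      off′ : onFoldLine (suc j) W′ ≡ false
      off′ = proj₁ (proj₂ (proj₂ pre))
      turn′ : foldStep (suc j) W′ ≡ (w , true)
      turn′ = proj₂ (proj₂ (proj₂ pre))
    by-case line (At.reflected _ st _) = turned line st
    by-line : ∀ b → onFoldLine (suc j) w ≡ b → foldPattern a (suc (suc j)) W ≡ foldColour a (suc j) w true
    by-line true  line = trans (turned-crease a j W w off turn line) (sym (foldColour-crease a j w line))
    by-line false line = by-case line (At.foldCase j w line)

  interior-suc : ∀ j w → Balanced w → InteriorTo (μ (suc j)) w → InteriorTo (μ (suc (suc j))) w
  interior-suc j w sum int =
    At.inPaper⇒interior j w sum (At.inCentral⇒inPaper j w (At.interior⇒inCentral j w int))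

  interior-+ : ∀ k j w → Balanced w → InteriorTo (μ (suc j)) w → InteriorTo (μ (suc (k ℕ.+ j))) w
  interior-+ zero    j w sum int = int
  interior-+ (suc k) j w sum int = interior-suc (k ℕ.+ j) w sum (interior-+ k j w sum int)

  foldColour-interior : ∀ a j w f → InteriorTo (μ (suc j)) w → foldColour a (suc j) w f ≡ foldColour a j w f
  foldColour-interior a j w f int = trans (foldColour-step a j w off fixed) (cong (foldColour a j w) (xor-identityʳ f))
    where
    off : onFoldLine (suc j) w ≡ false
    off = proj₁ (At.inCentral⇒fixed j w (At.interior⇒inCentral j w int))
    fixed : foldStep (suc j) w ≡ (w , false)
    fixed = proj₂ (At.inCentral⇒fixed j w (At.interior⇒inCentral j w int))

  foldColour-+ : ∀ a k j w f → Balanced w → InteriorTo (μ (suc j)) w →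
                 foldColour a (k ℕ.+ j) w f ≡ foldColour a j w f
  foldColour-+ a zero    j w f sum int = refl
  foldColour-+ a (suc k) j w f sum int =
    trans (foldColour-interior a (k ℕ.+ j) w f (interior-+ k j w sum int)) (foldColour-+ a k j w f sum int)

  foldPattern≡foldColour-≤ : ∀ a m n w → Balanced w → InteriorTo (μ (suc m)) w → m ℕ.≤ n →
                             foldPattern a m w ≡ foldColour a n w false
  foldPattern≡foldColour-≤ a m n w sum int m≤n = begin
    foldPattern a m w               ≡⟨ foldPattern≡foldColour a m w sum int ⟩
    foldColour a m w false          ≡⟨ foldColour-+ a (n ℕ.∸ m) m w false sum int ⟨
    foldColour a (n ℕ.∸ m ℕ.+ m) w false ≡⟨ cong (λ t → foldColour a t w false) (ℕP.m∸n+n≡m m≤n) ⟩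
    foldColour a n w false          ∎
    where open ≡-Reasoning

  foldPattern-independent : ∀ a m n w → Balanced w → InteriorTo (μ (suc m)) w → InteriorTo (μ (suc n)) w →
                            foldPattern a m w ≡ foldPattern a n w
  foldPattern-independent a m n w sum intm intn with ℕP.≤-total m n
  ... | inj₁ m≤n = trans (foldPattern≡foldColour-≤ a m n w sum intm m≤n) (sym (foldPattern≡foldColour a n w sum intn))
  ... | inj₂ n≤m = trans (foldPattern≡foldColour a m w sum intm) (sym (foldPattern≡foldColour-≤ a n m w sum intn n≤m))

  signum-neg⇒-[1+_] : ∀ {x} → signum x ≡ neg → ∃ λ n → x ≡ -[1+ n ]
  signum-neg⇒-[1+_] { -[1+ n ]} _ = n , refl
  signum-neg⇒-[1+_] {+ zero}    ()
  signum-neg⇒-[1+_] {+[1+ n ]} ()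

  side₀-neg : ∀ {x} → At.side 0 x ≡ neg → ∃ λ n → x ≡ -[1+ n ]
  side₀-neg {x} s = signum-neg⇒-[1+_] (trans (cong signum (sym (ℤP.+-identityʳ x))) s)

  noEdgeInside-T₀ : ∀ w → Balanced w → ¬ InteriorTo (μ 1) w
  noEdgeInside-T₀ w@(⟨ x , y , z ⟩) sum int with At.interior⇒inCentral 0 w int
  ... | s₁ , s₂ , s₃ with side₀-neg {x} s₁ | side₀-neg {y} s₂ | side₀-neg {z} s₃
  ...   | _ , refl | _ , refl | _ , refl with sum
  ...     | ()

  -- Halves of doubled edges

  data Tri : Set where
    t⁻ t⁰ t⁺ : Tri

  ⟦_⟧ : Tri → ℤ
  ⟦ t⁻ ⟧ = - + 1
  ⟦ t⁰ ⟧ = + 0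
  ⟦ t⁺ ⟧ = + 1

  -- The six unit directions of the grid, as increments of (u₁ , u₂ , u₃);
  -- alongᵢ± keeps uᵢ fixed.
  data Dir : Set where
    along₁⁺ along₁⁻ along₂⁺ along₂⁻ along₃⁺ along₃⁻ : Dir

  dirs : Dir → Tri × Tri × Tri
  dirs along₁⁺ = t⁰ , t⁺ , t⁻
  dirs along₁⁻ = t⁰ , t⁻ , t⁺
  dirs along₂⁺ = t⁻ , t⁰ , t⁺
  dirs along₂⁻ = t⁺ , t⁰ , t⁻
  dirs along₃⁺ = t⁺ , t⁻ , t⁰
  dirs along₃⁻ = t⁻ , t⁺ , t⁰

  dir₁ dir₂ dir₃ : Dir → Tri
  dir₁ δ = proj₁ (dirs δ)
  dir₂ δ = proj₁ (proj₂ (dirs δ))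
  dir₃ δ = proj₂ (proj₂ (dirs δ))

  vec : Dir → P3
  vec δ = ⟨ ⟦ dir₁ δ ⟧ , ⟦ dir₂ δ ⟧ , ⟦ dir₃ δ ⟧ ⟩

  reflectDir : Axis → Dir → Dir
  reflectDir axis₁ along₂⁺ = along₃⁺
  reflectDir axis₁ along₂⁻ = along₃⁻
  reflectDir axis₁ along₃⁺ = along₂⁺
  reflectDir axis₁ along₃⁻ = along₂⁻
  reflectDir axis₂ along₁⁺ = along₃⁺
  reflectDir axis₂ along₁⁻ = along₃⁻
  reflectDir axis₂ along₃⁺ = along₁⁺
  reflectDir axis₂ along₃⁻ = along₁⁻
  reflectDir axis₃ along₁⁺ = along₂⁺
  reflectDir axis₃ along₁⁻ = along₂⁻
  reflectDir axis₃ along₂⁺ = along₁⁺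
  reflectDir axis₃ along₂⁻ = along₁⁻
  reflectDir _     δ       = δ

  -- reflect i (+ 0) is the linear part of reflect i c
  vec-reflectDir : ∀ i δ → vec (reflectDir i δ) ≡ reflect i (+ 0) (vec δ)
  vec-reflectDir axis₁ along₁⁺ = refl
  vec-reflectDir axis₁ along₁⁻ = refl
  vec-reflectDir axis₁ along₂⁺ = refl
  vec-reflectDir axis₁ along₂⁻ = refl
  vec-reflectDir axis₁ along₃⁺ = refl
  vec-reflectDir axis₁ along₃⁻ = refl
  vec-reflectDir axis₂ along₁⁺ = refl
  vec-reflectDir axis₂ along₁⁻ = refl
  vec-reflectDir axis₂ along₂⁺ = refl
  vec-reflectDir axis₂ along₂⁻ = refl
  vec-reflectDir axis₂ along₃⁺ = refl
  vec-reflectDir axis₂ along₃⁻ = refl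
  vec-reflectDir axis₃ along₁⁺ = refl
  vec-reflectDir axis₃ along₁⁻ = refl
  vec-reflectDir axis₃ along₂⁺ = refl
  vec-reflectDir axis₃ along₂⁻ = refl
  vec-reflectDir axis₃ along₃⁺ = refl
  vec-reflectDir axis₃ along₃⁻ = refl

  reflectVertex : Axis → ℤ → P3 → P3
  reflectVertex axis₁ c ⟨ a , b , d ⟩ = ⟨ + 2 * c - a , b + a - c , d + a - c ⟩
  reflectVertex axis₂ c ⟨ a , b , d ⟩ = ⟨ a + b - c , + 2 * c - b , d + b - c ⟩
  reflectVertex axis₃ c ⟨ a , b , d ⟩ = ⟨ a + d - c , b + d - c , + 2 * c - d ⟩

  -- For a vertex u (coordinates u_i) and a unit direction v: the code of the edge from u
  -- to u + v, and the code of the half at the image of u of the image of that edge under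
  -- the homothety x ↦ -2x (which maps u_i to -2u_i - 1).
  edgeᵛ imageHalfᵛ : P3 → P3 → P3
  edgeᵛ u v = ⟨ + 2 * c₁ u + c₁ v , + 2 * c₂ u + c₂ v , + 2 * c₃ u + c₃ v ⟩
  imageHalfᵛ u v = ⟨ - + 4 * c₁ u - c₁ v - + 2 , - + 4 * c₂ u - c₂ v - + 2 , - + 4 * c₃ u - c₃ v - + 2 ⟩

  private
    edge-own : ∀ c u t → + 4 * c - (+ 2 * u + t) ≡ + 2 * (+ 2 * c - u) + (+ 4 * + 0 - t)
    edge-own = solve-∀
    edge-other : ∀ c u t u′ t′ → (+ 2 * u′ + t′) + (+ 2 * u + t) - + 2 * c
                                 ≡ + 2 * (u′ + u - c) + (t′ + t - + 2 * + 0)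
    edge-other = solve-∀
    half-own : ∀ c u t → + 4 * (- + 2 * c - + 1) - (- + 4 * u - t - + 2)
                         ≡ - + 4 * (+ 2 * c - u) - (+ 4 * + 0 - t) - + 2
    half-own = solve-∀
    half-other : ∀ c u t u′ t′ → (- + 4 * u′ - t′ - + 2) + (- + 4 * u - t - + 2) - + 2 * (- + 2 * c - + 1)
                                 ≡ - + 4 * (u′ + u - c) - (t′ + t - + 2 * + 0) - + 2
    half-other = solve-∀

  reflect-edgeᵛ : ∀ i c u v → reflect i c (edgeᵛ u v) ≡ edgeᵛ (reflectVertex i c u) (reflect i (+ 0) v)
  reflect-edgeᵛ axis₁ c ⟨ u₁ , u₂ , u₃ ⟩ ⟨ v₁ , v₂ , v₃ ⟩ =
    P3-ext (edge-own c u₁ v₁) (edge-other c u₁ v₁ u₂ v₂) (edge-other c u₁ v₁ u₃ v₃)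
  reflect-edgeᵛ axis₂ c ⟨ u₁ , u₂ , u₃ ⟩ ⟨ v₁ , v₂ , v₃ ⟩ =
    P3-ext (edge-other c u₂ v₂ u₁ v₁) (edge-own c u₂ v₂) (edge-other c u₂ v₂ u₃ v₃)
  reflect-edgeᵛ axis₃ c ⟨ u₁ , u₂ , u₃ ⟩ ⟨ v₁ , v₂ , v₃ ⟩ =
    P3-ext (edge-other c u₃ v₃ u₁ v₁) (edge-other c u₃ v₃ u₂ v₂) (edge-own c u₃ v₃)

  reflect₁-imageHalfᵛ : ∀ c u v → reflect₁ (- + 2 * c - + 1) (imageHalfᵛ u v)
                                   ≡ imageHalfᵛ (reflectVertex axis₁ c u) (reflect₁ (+ 0) v)
  reflect₁-imageHalfᵛ c ⟨ u₁ , u₂ , u₃ ⟩ ⟨ v₁ , v₂ , v₃ ⟩ =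
    P3-ext (half-own c u₁ v₁) (half-other c u₁ v₁ u₂ v₂) (half-other c u₁ v₁ u₃ v₃)

  reflect₂-imageHalfᵛ : ∀ c u v → reflect₂ (- + 2 * c - + 1) (imageHalfᵛ u v)
                                   ≡ imageHalfᵛ (reflectVertex axis₂ c u) (reflect₂ (+ 0) v)
  reflect₂-imageHalfᵛ c ⟨ u₁ , u₂ , u₃ ⟩ ⟨ v₁ , v₂ , v₃ ⟩ =
    P3-ext (half-other c u₂ v₂ u₁ v₁) (half-own c u₂ v₂) (half-other c u₂ v₂ u₃ v₃)

  reflect₃-imageHalfᵛ : ∀ c u v → reflect₃ (- + 2 * c - + 1) (imageHalfᵛ u v)
                                   ≡ imageHalfᵛ (reflectVertex axis₃ c u) (reflect₃ (+ 0) v)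
  reflect₃-imageHalfᵛ c ⟨ u₁ , u₂ , u₃ ⟩ ⟨ v₁ , v₂ , v₃ ⟩ =
    P3-ext (half-other c u₃ v₃ u₁ v₁) (half-other c u₃ v₃ u₂ v₂) (half-own c u₃ v₃)

  reflect-imageHalfᵛ : ∀ i c u v → reflect i (- + 2 * c - + 1) (imageHalfᵛ u v)
                                    ≡ imageHalfᵛ (reflectVertex i c u) (reflect i (+ 0) v)
  reflect-imageHalfᵛ axis₁ = reflect₁-imageHalfᵛ
  reflect-imageHalfᵛ axis₂ = reflect₂-imageHalfᵛ
  reflect-imageHalfᵛ axis₃ = reflect₃-imageHalfᵛ

  edge imageHalf : P3 → Dir → P3
  edge u δ = edgeᵛ u (vec δ)
  imageHalf u δ = imageHalfᵛ u (vec δ)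

  reflect-edge : ∀ i c u δ → reflect i c (edge u δ) ≡ edge (reflectVertex i c u) (reflectDir i δ)
  reflect-edge i c u δ =
    trans (reflect-edgeᵛ i c u (vec δ)) (cong (edgeᵛ (reflectVertex i c u)) (sym (vec-reflectDir i δ)))

  reflect-imageHalf : ∀ i j u δ → reflect i (foldLine (suc j)) (imageHalf u δ)
                                   ≡ imageHalf (reflectVertex i (foldLine j) u) (reflectDir i δ)
  reflect-imageHalf i j u δ = begin
    reflect i (foldLine (suc j)) (imageHalf u δ)
      ≡⟨ cong (λ c → reflect i c (imageHalf u δ)) (foldLine-suc j) ⟩
    reflect i (- + 2 * foldLine j - + 1) (imageHalfᵛ u (vec δ))
      ≡⟨ reflect-imageHalfᵛ i (foldLine j) u (vec δ) ⟩
    imageHalfᵛ (reflectVertex i (foldLine j) u) (reflect i (+ 0) (vec δ))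
      ≡⟨ cong (imageHalfᵛ (reflectVertex i (foldLine j) u)) (vec-reflectDir i δ) ⟨
    imageHalf (reflectVertex i (foldLine j) u) (reflectDir i δ) ∎
    where open ≡-Reasoning

  -- The nonzero cases are rewritten into a form whose signum computes.
  signum-4x+t≡signum-2x+t : ∀ x t → signum (+ 4 * x + ⟦ t ⟧) ≡ signum (+ 2 * x + ⟦ t ⟧)
  signum-4x+t≡signum-2x+t (+ zero) t⁻ = refl
  signum-4x+t≡signum-2x+t (+ zero) t⁰ = refl
  signum-4x+t≡signum-2x+t (+ zero) t⁺ = refl
  signum-4x+t≡signum-2x+t +[1+ n ] t =
    trans (cong signum (l₄ (+ n) ⟦ t ⟧)) (trans (positive _ t) (sym (trans (cong signum (l₂ (+ n) ⟦ t ⟧)) (positive _ t))))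
    where
    positive : ∀ k t → signum (+ 1 + (+ k + (+ 1 + ⟦ t ⟧))) ≡ pos
    positive k t⁻ = refl
    positive k t⁰ = refl
    positive k t⁺ = refl
    l₄ : ∀ n d → + 4 * (+ 1 + n) + d ≡ + 1 + ((n + n + (n + n) + + 2) + (+ 1 + d))
    l₄ = solve-∀
    l₂ : ∀ n d → + 2 * (+ 1 + n) + d ≡ + 1 + ((n + n) + (+ 1 + d))
    l₂ = solve-∀
  signum-4x+t≡signum-2x+t -[1+ n ] t =
    trans (cong signum (l₄ (+ n) ⟦ t ⟧)) (trans (negative _ t) (sym (trans (cong signum (l₂ (+ n) ⟦ t ⟧)) (negative _ t))))
    where
    negative : ∀ k t → signum (- (+ 1 + (+ k + (+ 1 - ⟦ t ⟧)))) ≡ neg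
    negative k t⁻ = refl
    negative k t⁰ = refl
    negative k t⁺ = refl
    l₄ : ∀ n d → + 4 * (- (+ 1 + n)) + d ≡ - (+ 1 + ((n + n + (n + n) + + 2) + (+ 1 - d)))
    l₄ = solve-∀
    l₂ : ∀ n d → + 2 * (- (+ 1 + n)) + d ≡ - (+ 1 + ((n + n) + (+ 1 - d)))
    l₂ = solve-∀

  side-imageHalf : ∀ j u t → At.side (suc j) (- + 4 * u - ⟦ t ⟧ - + 2) ≡ At.side j (+ 2 * u + ⟦ t ⟧)
  side-imageHalf j u t = begin
    signum (- + 2 * μ (suc j)) ⊛ signum (- + 4 * u - ⟦ t ⟧ - + 2 - + 2 * foldLine (suc j))
      ≡⟨ cong₂ _⊛_ (signum-* (- + 2) (μ (suc j))) (cong signum half-offset) ⟩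
    (neg ⊛ σ) ⊛ signum (- (+ 4 * (u - c) + ⟦ t ⟧))
      ≡⟨ cong ((neg ⊛ σ) ⊛_) (signum-neg (+ 4 * (u - c) + ⟦ t ⟧)) ⟩
    (neg ⊛ σ) ⊛ negateˢ (signum (+ 4 * (u - c) + ⟦ t ⟧))
      ≡⟨ ⊛-neg-negateˢ σ _ ⟩
    σ ⊛ signum (+ 4 * (u - c) + ⟦ t ⟧)
      ≡⟨ cong (σ ⊛_) (signum-4x+t≡signum-2x+t (u - c) t) ⟩
    σ ⊛ signum (+ 2 * (u - c) + ⟦ t ⟧)
      ≡⟨ cong (λ y → σ ⊛ signum y) (edge-offset c u ⟦ t ⟧) ⟨
    σ ⊛ signum (+ 2 * u + ⟦ t ⟧ - + 2 * c) ∎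
    where
    open ≡-Reasoning
    c = foldLine j
    σ = signum (μ (suc j))
    half-offset : - + 4 * u - ⟦ t ⟧ - + 2 - + 2 * foldLine (suc j) ≡ - (+ 4 * (u - c) + ⟦ t ⟧)
    half-offset = trans (cong (λ c′ → - + 4 * u - ⟦ t ⟧ - + 2 - + 2 * c′) (foldLine-suc j)) (l c u ⟦ t ⟧)
      where
      l : ∀ c u d → - + 4 * u - d - + 2 - + 2 * (- + 2 * c - + 1) ≡ - (+ 4 * (u - c) + d)
      l = solve-∀
    edge-offset : ∀ c u d → + 2 * u + d - + 2 * c ≡ + 2 * (u - c) + d
    edge-offset = solve-∀

  data Commutes (j : ℕ) (u : P3) (δ : Dir) : Set where
    commutes : ∀ u′ δ′ g → foldStep (suc j) (edge u δ) ≡ (edge u′ δ′ , g) →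
               foldStep (suc (suc j)) (imageHalf u δ) ≡ (imageHalf u′ δ′ , g) → Commutes j u δ

  fold-commutes : ∀ j u δ → Commutes j u δ
  fold-commutes j u δ =
    by-corners (isPos s₁) (isPos s₂) (isPos s₃)
      (At.step-by-sides j e s₁ s₂ s₃ refl refl refl)
      (At.step-by-sides (suc j) h s₁ s₂ s₃ (side-imageHalf j (c₁ u) (dir₁ δ))
        (side-imageHalf j (c₂ u) (dir₂ δ)) (side-imageHalf j (c₃ u) (dir₃ δ)))
    where
    e = edge u δ
    h = imageHalf u δ
    s₁ = At.side j (c₁ e)
    s₂ = At.side j (c₂ e)
    s₃ = At.side j (c₃ e)
    reflected : ∀ i → foldStep (suc j) e ≡ (reflect i (foldLine j) e , true) →
                foldStep (suc (suc j)) h ≡ (reflect i (foldLine (suc j)) h , true) → Commutes j u δ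
    reflected i se sh = commutes (reflectVertex i (foldLine j) u) (reflectDir i δ) true
      (trans se (cong (_, true) (reflect-edge i (foldLine j) u δ)))
      (trans sh (cong (_, true) (reflect-imageHalf i j u δ)))
    by-corners : ∀ b₁ b₂ b₃ → foldStep (suc j) e ≡ At.stepByCorners j b₁ b₂ b₃ e →
                 foldStep (suc (suc j)) h ≡ At.stepByCorners (suc j) b₁ b₂ b₃ h → Commutes j u δ
    by-corners true  _     _     se sh = reflected axis₁ se sh
    by-corners false true  _     se sh = reflected axis₂ se sh
    by-corners false false true  se sh = reflected axis₃ se sh
    by-corners false false false se sh = commutes u δ false se sh

  onFoldLine-imageHalf : ∀ j u δ → onFoldLine (suc (suc j)) (imageHalf u δ) ≡ onFoldLine (suc j) (edge u δ)
  onFoldLine-imageHalf j u δ = begin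
    onFoldLine (suc (suc j)) (imageHalf u δ)
      ≡⟨ At.onLine≡ (suc j) (imageHalf u δ) ⟩
    isNil (At.side (suc j) (c₁ h)) ∨ isNil (At.side (suc j) (c₂ h)) ∨ isNil (At.side (suc j) (c₃ h))
      ≡⟨ cong₂ _∨_ (cong isNil (side-imageHalf j (c₁ u) (dir₁ δ)))
           (cong₂ _∨_ (cong isNil (side-imageHalf j (c₂ u) (dir₂ δ)))
                      (cong isNil (side-imageHalf j (c₃ u) (dir₃ δ)))) ⟩
    isNil (At.side j (c₁ e)) ∨ isNil (At.side j (c₂ e)) ∨ isNil (At.side j (c₃ e))
      ≡⟨ At.onLine≡ j (edge u δ) ⟨
    onFoldLine (suc j) (edge u δ) ∎
    where
    open ≡-Reasoning
    e = edge u δ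
    h = imageHalf u δ

  interior-imageHalf⇒edge : ∀ j u δ → InteriorTo (μ (suc (suc j))) (imageHalf u δ) → InteriorTo (μ (suc j)) (edge u δ)
  interior-imageHalf⇒edge j u δ int =
    At.inCentral⇒interior j (edge u δ) (transfer (At.interior⇒inCentral (suc j) (imageHalf u δ) int))
    where
    transfer : At.InCentral (suc j) (imageHalf u δ) → At.InCentral j (edge u δ)
    transfer (s₁ , s₂ , s₃) = trans (sym (side-imageHalf j (c₁ u) (dir₁ δ))) s₁
                            , trans (sym (side-imageHalf j (c₂ u) (dir₂ δ))) s₂
                            , trans (sym (side-imageHalf j (c₃ u) (dir₃ δ))) s₃

  vec-sum : ∀ δ → ⟦ dir₁ δ ⟧ + ⟦ dir₂ δ ⟧ + ⟦ dir₃ δ ⟧ ≡ + 0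
  vec-sum along₁⁺ = refl
  vec-sum along₁⁻ = refl
  vec-sum along₂⁺ = refl
  vec-sum along₂⁻ = refl
  vec-sum along₃⁺ = refl
  vec-sum along₃⁻ = refl

  balanced-imageHalf⇒edge : ∀ u δ → Balanced (imageHalf u δ) → Balanced (edge u δ)
  balanced-imageHalf⇒edge u δ sum = ℤP.*-cancelˡ-≡ (+ 2) _ _ (begin
    + 2 * (e₁ + e₂ + e₃)                   ≡⟨ l (c₁ u) (c₂ u) (c₃ u) ⟦ dir₁ δ ⟧ ⟦ dir₂ δ ⟧ ⟦ dir₃ δ ⟧ ⟩
    (⟦ dir₁ δ ⟧ + ⟦ dir₂ δ ⟧ + ⟦ dir₃ δ ⟧) - + 6 - (h₁ + h₂ + h₃)
                                           ≡⟨ cong₂ (λ x y → x - + 6 - y) (vec-sum δ) sum ⟩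
    + 2 * - + 2                            ∎)
    where
    open ≡-Reasoning
    e₁ = c₁ (edge u δ)
    e₂ = c₂ (edge u δ)
    e₃ = c₃ (edge u δ)
    h₁ = c₁ (imageHalf u δ)
    h₂ = c₂ (imageHalf u δ)
    h₃ = c₃ (imageHalf u δ)
    l : ∀ u₁ u₂ u₃ d₁ d₂ d₃ →
        + 2 * ((+ 2 * u₁ + d₁) + (+ 2 * u₂ + d₂) + (+ 2 * u₃ + d₃))
        ≡ (d₁ + d₂ + d₃) - + 6 - ((- + 4 * u₁ - d₁ - + 2) + (- + 4 * u₂ - d₂ - + 2) + (- + 4 * u₃ - d₃ - + 2))
    l = solve-∀

  -- Self-similarity under x ↦ -2x.
  foldColour-imageHalf : ∀ a j u δ f → Balanced (imageHalf u δ) → InteriorTo (μ (suc (suc j))) (imageHalf u δ) →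
                          foldColour a (suc j) (imageHalf u δ) f ≡ foldColour (a ∘ suc) j (edge u δ) f
  foldColour-imageHalf a zero u δ f sum int =
    contradiction (interior-imageHalf⇒edge zero u δ int) (noEdgeInside-T₀ (edge u δ) (balanced-imageHalf⇒edge u δ sum))
  foldColour-imageHalf a (suc j) u δ f sum int = by-line (onFoldLine (suc j) e) refl
    where
    open ≡-Reasoning
    e = edge u δ
    h = imageHalf u δ
    by-line : ∀ b → onFoldLine (suc j) e ≡ b → foldColour a (suc (suc j)) h f ≡ foldColour (a ∘ suc) (suc j) e f
    by-line true  line = trans (foldColour-crease a (suc j) h (trans (onFoldLine-imageHalf j u δ) line))
                               (sym (foldColour-crease (a ∘ suc) j e line))
    by-line false line = by-step (fold-commutes j u δ)
      where
      off : onFoldLine (suc (suc j)) h ≡ false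
      off = trans (onFoldLine-imageHalf j u δ) line
      by-step : Commutes j u δ → foldColour a (suc (suc j)) h f ≡ foldColour (a ∘ suc) (suc j) e f
      by-step (commutes u′ δ′ g se sh) = begin
        foldColour a (suc (suc j)) h f                  ≡⟨ foldColour-step a (suc j) h off sh ⟩
        foldColour a (suc j) (imageHalf u′ δ′) (f xor g)
          ≡⟨ foldColour-imageHalf a j u′ δ′ (f xor g) (proj₂ reached) (proj₁ reached) ⟩
        foldColour (a ∘ suc) j (edge u′ δ′) (f xor g)   ≡⟨ foldColour-step (a ∘ suc) j e line se ⟨
        foldColour (a ∘ suc) (suc j) e f                ∎
        where
        reached : InteriorTo (μ (suc (suc j))) (imageHalf u′ δ′) × Balanced (imageHalf u′ δ′)
        reached = At.step-into-interior (suc j) h sh sum int off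

  -- New edges

  ∨₃-false : ∀ {x y z} → x ≡ false → y ≡ false → z ≡ false → (x ∨ y ∨ z) ≡ false
  ∨₃-false refl refl refl = refl

  bit : Bool → ℤ
  bit true  = + 0
  bit false = + 1

  -- The odd coordinates are ≡ 1 - 2β (mod 4), the even one (at axis i) is ≡ 0.
  newCodeᵝ : Axis → ℤ → ℤ → ℤ → ℤ → P3
  newCodeᵝ axis₁ β p q s = ⟨ + 4 * p , + 4 * q + (+ 1 - + 2 * β) , + 4 * s + (+ 1 - + 2 * β) ⟩
  newCodeᵝ axis₂ β p q s = ⟨ + 4 * q + (+ 1 - + 2 * β) , + 4 * p , + 4 * s + (+ 1 - + 2 * β) ⟩
  newCodeᵝ axis₃ β p q s = ⟨ + 4 * q + (+ 1 - + 2 * β) , + 4 * s + (+ 1 - + 2 * β) , + 4 * p ⟩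

  newCode : Axis → Bool → ℤ → ℤ → ℤ → P3
  newCode i b = newCodeᵝ i (bit b)

  -- The edges that are not halves of doubled edges.
  data NewEdge (w : P3) (b : Bool) : Set where
    newEdge : ∀ i p q s → w ≡ newCode i b p q s → NewEdge w b

  private
    bit-not : ∀ b → bit (not b) ≡ + 1 - bit b
    bit-not true  = refl
    bit-not false = refl

    new-own-even : ∀ h p → + 4 * (+ 2 * h + + 1) - + 4 * p ≡ + 4 * (+ 2 * h + + 1 - p)
    new-own-even = solve-∀
    new-own-odd : ∀ h q β → + 4 * (+ 2 * h + + 1) - (+ 4 * q + (+ 1 - + 2 * β))
                            ≡ + 4 * (+ 2 * h + + 1 - q) + (+ 1 - + 2 * (+ 1 - β))
    new-own-odd = solve-∀
    new-odd+even : ∀ h q p β → (+ 4 * q + (+ 1 - + 2 * β)) + + 4 * p - + 2 * (+ 2 * h + + 1)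
                               ≡ + 4 * (q + p - h - β) + (+ 1 - + 2 * (+ 1 - β))
    new-odd+even = solve-∀
    new-even+odd : ∀ h p q β → + 4 * p + (+ 4 * q + (+ 1 - + 2 * β)) - + 2 * (+ 2 * h + + 1)
                               ≡ + 4 * (p + q - h - β) + (+ 1 - + 2 * (+ 1 - β))
    new-even+odd = solve-∀
    new-odd+odd : ∀ h q s β → (+ 4 * q + (+ 1 - + 2 * β)) + (+ 4 * s + (+ 1 - + 2 * β)) - + 2 * (+ 2 * h + + 1)
                              ≡ + 4 * (q + s - h - β)
    new-odd+odd = solve-∀

    along : ∀ {w w′ b} k c → w ≡ w′ → NewEdge (reflect k c w′) b → NewEdge (reflect k c w) b
    along k c eq = subst (λ x → NewEdge (reflect k c x) _) (sym eq)

    flipped : ∀ {w} i b p q s → w ≡ newCodeᵝ i (+ 1 - bit b) p q s → NewEdge w (not b)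
    flipped i b p q s eq = newEdge i p q s (trans eq (cong (λ β → newCodeᵝ i β p q s) (sym (bit-not b))))

  reflect-newEdge : ∀ k h w b → NewEdge w b → NewEdge (reflect k (+ 2 * h + + 1) w) (not b)
  reflect-newEdge axis₁ h w b (newEdge axis₁ p q s eq) = along axis₁ (+ 2 * h + + 1) eq
    (flipped axis₁ b (+ 2 * h + + 1 - p) (q + p - h - bit b) (s + p - h - bit b)
      (P3-ext (new-own-even h p) (new-odd+even h q p (bit b)) (new-odd+even h s p (bit b))))
  reflect-newEdge axis₁ h w b (newEdge axis₂ p q s eq) = along axis₁ (+ 2 * h + + 1) eq
    (flipped axis₃ b (s + q - h - bit b) (+ 2 * h + + 1 - q) (p + q - h - bit b)
      (P3-ext (new-own-odd h q (bit b)) (new-even+odd h p q (bit b)) (new-odd+odd h s q (bit b))))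
  reflect-newEdge axis₁ h w b (newEdge axis₃ p q s eq) = along axis₁ (+ 2 * h + + 1) eq
    (flipped axis₂ b (s + q - h - bit b) (+ 2 * h + + 1 - q) (p + q - h - bit b)
      (P3-ext (new-own-odd h q (bit b)) (new-odd+odd h s q (bit b)) (new-even+odd h p q (bit b))))
  reflect-newEdge axis₂ h w b (newEdge axis₁ p q s eq) = along axis₂ (+ 2 * h + + 1) eq
    (flipped axis₃ b (s + q - h - bit b) (p + q - h - bit b) (+ 2 * h + + 1 - q)
      (P3-ext (new-even+odd h p q (bit b)) (new-own-odd h q (bit b)) (new-odd+odd h s q (bit b))))
  reflect-newEdge axis₂ h w b (newEdge axis₂ p q s eq) = along axis₂ (+ 2 * h + + 1) eq
    (flipped axis₂ b (+ 2 * h + + 1 - p) (q + p - h - bit b) (s + p - h - bit b)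
      (P3-ext (new-odd+even h q p (bit b)) (new-own-even h p) (new-odd+even h s p (bit b))))
  reflect-newEdge axis₂ h w b (newEdge axis₃ p q s eq) = along axis₂ (+ 2 * h + + 1) eq
    (flipped axis₁ b (q + s - h - bit b) (+ 2 * h + + 1 - s) (p + s - h - bit b)
      (P3-ext (new-odd+odd h q s (bit b)) (new-own-odd h s (bit b)) (new-even+odd h p s (bit b))))
  reflect-newEdge axis₃ h w b (newEdge axis₁ p q s eq) = along axis₃ (+ 2 * h + + 1) eq
    (flipped axis₂ b (q + s - h - bit b) (p + s - h - bit b) (+ 2 * h + + 1 - s)
      (P3-ext (new-even+odd h p s (bit b)) (new-odd+odd h q s (bit b)) (new-own-odd h s (bit b))))
  reflect-newEdge axis₃ h w b (newEdge axis₂ p q s eq) = along axis₃ (+ 2 * h + + 1) eq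
    (flipped axis₁ b (q + s - h - bit b) (p + s - h - bit b) (+ 2 * h + + 1 - s)
      (P3-ext (new-odd+odd h q s (bit b)) (new-even+odd h p s (bit b)) (new-own-odd h s (bit b))))
  reflect-newEdge axis₃ h w b (newEdge axis₃ p q s eq) = along axis₃ (+ 2 * h + + 1) eq
    (flipped axis₃ b (+ 2 * h + + 1 - p) (q + p - h - bit b) (s + p - h - bit b)
      (P3-ext (new-odd+even h q p (bit b)) (new-odd+even h s p (bit b)) (new-own-even h p)))

  private
    4p≢2[2h+1] : ∀ p h → + 4 * p ≢ + 2 * (+ 2 * h + + 1)
    4p≢2[2h+1] p h eq = residues-differ 4 p h 0 2 (residue<4 ʳ0) (residue<4 ʳ2) (λ ())
                          (trans (l₁ p) (trans eq (l₂ h)))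
      where
      l₁ : ∀ p → + 0 + p * + 4 ≡ + 4 * p
      l₁ = solve-∀
      l₂ : ∀ h → + 2 * (+ 2 * h + + 1) ≡ + 2 + h * + 4
      l₂ = solve-∀

    odd≢2[2h+1] : ∀ q β h → + 4 * q + (+ 1 - + 2 * β) ≢ + 2 * (+ 2 * h + + 1)
    odd≢2[2h+1] q β h eq = residues-differ 2 (+ 2 * q - β) (+ 2 * h + + 1) 1 0 (ℕ.s<s ℕ.z<s) ℕ.z<s (λ ())
                             (trans (l₁ q β) (trans eq (l₂ h)))
      where
      l₁ : ∀ q β → + 1 + (+ 2 * q - β) * + 2 ≡ + 4 * q + (+ 1 - + 2 * β)
      l₁ = solve-∀
      l₂ : ∀ h → + 2 * (+ 2 * h + + 1) ≡ + 0 + (+ 2 * h + + 1) * + 2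
      l₂ = solve-∀

    not-on : ∀ {x y} → x ≢ y → does (x ℤ.≟ y) ≡ false
    not-on {x} {y} = dec-false (x ℤ.≟ y)

  newEdge-offOddLines : ∀ h w b → NewEdge w b → onLineAt (+ 2 * h + + 1) w ≡ false
  newEdge-offOddLines h w b (newEdge i p q s eq) = subst (λ x → onLineAt (+ 2 * h + + 1) x ≡ false) (sym eq) (by-axis i)
    where
    by-axis : ∀ i → onLineAt (+ 2 * h + + 1) (newCode i b p q s) ≡ false
    by-axis axis₁ = ∨₃-false (not-on (4p≢2[2h+1] p h)) (not-on (odd≢2[2h+1] q (bit b) h)) (not-on (odd≢2[2h+1] s (bit b) h))
    by-axis axis₂ = ∨₃-false (not-on (odd≢2[2h+1] q (bit b) h)) (not-on (4p≢2[2h+1] p h)) (not-on (odd≢2[2h+1] s (bit b) h))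
    by-axis axis₃ = ∨₃-false (not-on (odd≢2[2h+1] q (bit b) h)) (not-on (odd≢2[2h+1] s (bit b) h)) (not-on (4p≢2[2h+1] p h))

  foldLine-odd : ∀ j → foldLine (suc j) ≡ + 2 * (- foldLine j - + 1) + + 1
  foldLine-odd j = trans (foldLine-suc j) (l (foldLine j))
    where
    l : ∀ c → - + 2 * c - + 1 ≡ + 2 * (- c - + 1) + + 1
    l = solve-∀

  newEdge-offFoldLine : ∀ j w b → NewEdge w b → onFoldLine (suc (suc j)) w ≡ false
  newEdge-offFoldLine j w b nw =
    subst (λ c → onLineAt c w ≡ false) (sym (foldLine-odd j)) (newEdge-offOddLines (- foldLine j - + 1) w b nw)

  reflect-newEdge-atFold : ∀ i j w b → NewEdge w b → NewEdge (reflect i (foldLine (suc j)) w) (not b)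
  reflect-newEdge-atFold i j w b nw =
    subst (λ c → NewEdge (reflect i c w) (not b)) (sym (foldLine-odd j)) (reflect-newEdge i (- foldLine j - + 1) w b nw)

  private
    ≥-1 : ∀ x → signum (- + 2 - x) ≡ neg → x ≡ - + 1 ⊎ ∃ λ n → x ≡ + n
    ≥-1 (+ n)              _ = inj₂ (n , refl)
    ≥-1 -[1+ zero ]        _ = inj₁ refl
    ≥-1 -[1+ suc zero ]    ()
    ≥-1 -[1+ suc (suc n) ] ()

    ≥-1-inside-−2T₀ : ∀ x y z → x + y + z ≡ - + 2 → At.pairSide 0 y z ≡ neg → x ≡ - + 1 ⊎ ∃ λ n → x ≡ + n
    ≥-1-inside-−2T₀ x y z sum s = ≥-1 x (trans (cong signum (trans (cong (_- x) (sym sum)) (l x y z))) s)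
      where
      l : ∀ x y z → x + y + z - x ≡ (y + - (+ 2 * + 0)) + (z + - (+ 2 * + 0))
      l = solve-∀

    4p≢-1 : ∀ p → + 4 * p ≢ - + 1
    4p≢-1 p eq = residues-differ 4 p (- + 1) 0 3 (residue<4 ʳ0) (residue<4 ʳ3) (λ ()) (trans (l p) eq)
      where
      l : ∀ p → + 0 + p * + 4 ≡ + 4 * p
      l = solve-∀

    4q+1≢-1 : ∀ q → + 4 * q + (+ 1 - + 2 * bit true) ≢ - + 1
    4q+1≢-1 q eq = residues-differ 4 q (- + 1) 1 3 (residue<4 ʳ1) (residue<4 ʳ3) (λ ()) (trans (l q) eq)
      where
      l : ∀ q → + 1 + q * + 4 ≡ + 4 * q + (+ 1 - + 2 * + 0)
      l = solve-∀

    newCode-true≢-1 : ∀ i p q s → let w = newCode i true p q s in (c₁ w ≢ - + 1) × (c₂ w ≢ - + 1) × (c₃ w ≢ - + 1)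
    newCode-true≢-1 axis₁ p q s = 4p≢-1 p , 4q+1≢-1 q , 4q+1≢-1 s
    newCode-true≢-1 axis₂ p q s = 4q+1≢-1 q , 4p≢-1 p , 4q+1≢-1 s
    newCode-true≢-1 axis₃ p q s = 4q+1≢-1 q , 4q+1≢-1 s , 4p≢-1 p

    nonNegative : ∀ {x} → x ≡ - + 1 ⊎ ∃ (λ n → x ≡ + n) → x ≢ - + 1 → ∃ λ n → x ≡ + n
    nonNegative (inj₁ x≡-1) x≢-1 = contradiction x≡-1 x≢-1
    nonNegative (inj₂ x≥0)  _    = x≥0

  -- Inside -2T₀ all coordinates are ≥ -1, while a new edge with b = true has no
  -- coordinate ≡ -1 (mod 4); so its coordinates would be ≥ 0, contradicting Balanced.
  newEdge-inside-−2T₀ : ∀ w b → NewEdge w b → Balanced w → InteriorTo (μ 2) w → b ≡ false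
  newEdge-inside-−2T₀ w false _ _ _ = refl
  newEdge-inside-−2T₀ w@(⟨ x , y , z ⟩) true (newEdge i p q s eq) sum int
    with nonNegative (≥-1-inside-−2T₀ x y z sum (proj₁ out)) (≢ c₁ (proj₁ ≢-1))
       | nonNegative (≥-1-inside-−2T₀ y z x (rotate-sum x y z sum) (proj₁ (proj₂ out))) (≢ c₂ (proj₁ (proj₂ ≢-1)))
       | nonNegative (≥-1-inside-−2T₀ z x y (rotate-sum y z x (rotate-sum x y z sum)) (proj₂ (proj₂ out))) (≢ c₃ (proj₂ (proj₂ ≢-1)))
    where
    out = At.interior⇒inPaper 0 w sum int
    ≢-1 = newCode-true≢-1 i p q s
    ≢ : ∀ (cᵢ : P3 → ℤ) → cᵢ (newCode i true p q s) ≢ - + 1 → cᵢ w ≢ - + 1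
    ≢ cᵢ ne e = ne (trans (cong cᵢ (sym eq)) e)
  ... | _ , refl | _ , refl | _ , refl with sum
  ...   | ()

  private
    xor-true-not : ∀ f b → (f xor true) xor not b ≡ f xor b
    xor-true-not true  true  = refl
    xor-true-not true  false = refl
    xor-true-not false true  = refl
    xor-true-not false false = refl

  -- A new edge is a crease of the last folding a₁; each reflection turns over both
  -- the layer and the parity b.
  foldColour-newEdge : ∀ a j w b f → NewEdge w b → Balanced w → InteriorTo (μ (suc (suc j))) w →
                       foldColour a (suc j) w f ≡ creaseColour (a 1) (f xor b)
  foldColour-newEdge a zero w b f nw sum int = by-line (onFoldLine 1 w) refl
    where
    by-line : ∀ l → onFoldLine 1 w ≡ l → foldColour a 1 w f ≡ creaseColour (a 1) (f xor b)
    by-line true  line = begin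
      foldColour a 1 w f          ≡⟨ foldColour-crease a 0 w line ⟩
      creaseColour (a 1) f        ≡⟨ cong (creaseColour (a 1)) (xor-identityʳ f) ⟨
      creaseColour (a 1) (f xor false) ≡⟨ cong (λ b → creaseColour (a 1) (f xor b)) (newEdge-inside-−2T₀ w b nw sum int) ⟨
      creaseColour (a 1) (f xor b) ∎
      where open ≡-Reasoning
    by-line false line = contradiction (proj₁ reached) (noEdgeInside-T₀ (proj₁ (foldStep 1 w)) (proj₂ reached))
      where
      reached : InteriorTo (μ 1) (proj₁ (foldStep 1 w)) × Balanced (proj₁ (foldStep 1 w))
      reached = At.step-into-interior 0 w refl sum int line
  foldColour-newEdge a (suc j) w b f nw sum int = by-case (At.foldCase (suc j) w line)
    where
    open ≡-Reasoning
    line : onFoldLine (suc (suc j)) w ≡ false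
    line = newEdge-offFoldLine j w b nw
    by-case : At.FoldCase (suc j) w → foldColour a (suc (suc j)) w f ≡ creaseColour (a 1) (f xor b)
    by-case (At.stays st ins) = begin
      foldColour a (suc (suc j)) w f             ≡⟨ foldColour-step a (suc j) w line st ⟩
      foldColour a (suc j) w (f xor false)       ≡⟨ foldColour-newEdge a j w b _ nw sum (At.inCentral⇒interior (suc j) w ins) ⟩
      creaseColour (a 1) ((f xor false) xor b)   ≡⟨ cong (λ g → creaseColour (a 1) (g xor b)) (xor-identityʳ f) ⟩
      creaseColour (a 1) (f xor b)               ∎
    by-case (At.reflected i st _) = begin
      foldColour a (suc (suc j)) w f             ≡⟨ foldColour-step a (suc j) w line st ⟩
      foldColour a (suc j) w′ (f xor true)       ≡⟨ foldColour-newEdge a j w′ (not b) _ nw′ (proj₂ reached) (proj₁ reached) ⟩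
      creaseColour (a 1) ((f xor true) xor not b) ≡⟨ cong (creaseColour (a 1)) (xor-true-not f b) ⟩
      creaseColour (a 1) (f xor b)               ∎
      where
      w′ = reflect i (foldLine (suc j)) w
      nw′ : NewEdge w′ (not b)
      nw′ = reflect-newEdge-atFold i j w b nw
      reached : InteriorTo (μ (suc (suc j))) w′ × Balanced w′
      reached = At.step-into-interior (suc j) w st sum int line

  -- Classification of edges

  evenʳ : Residue → Bool
  evenʳ ʳ0 = true
  evenʳ ʳ1 = false
  evenʳ ʳ2 = true
  evenʳ ʳ3 = false

  count : Bool → ℕ
  count b = if b then 1 else 0

  private
    mod2≡ : ∀ {x} k r → r ℕ.< 2 → x ≡ + r + k * + 2 → x %ℕ 2 ≡ r
    mod2≡ k r r<2 e = trans (cong (_%ℕ 2) e) ([r+q*d]%ℕd≡r 2 k r r<2)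


  mod4-view : ∀ x → ∃₂ λ q r → x ≡ + ⟦ r ⟧ʳ + q * + 4
  mod4-view x = by-residue (x %ℕ 4) (ℤD.n%ℕd<d x 4) (ℤD.a≡a%ℕn+[a/ℕn]*n x 4)
    where
    by-residue : ∀ n → n ℕ.< 4 → x ≡ + n + (x /ℕ 4) * + 4 → ∃₂ λ q r → x ≡ + ⟦ r ⟧ʳ + q * + 4
    by-residue 0 _ e = x /ℕ 4 , ʳ0 , e
    by-residue 1 _ e = x /ℕ 4 , ʳ1 , e
    by-residue 2 _ e = x /ℕ 4 , ʳ2 , e
    by-residue 3 _ e = x /ℕ 4 , ʳ3 , e
    by-residue (suc (suc (suc (suc _)))) (ℕ.s≤s (ℕ.s≤s (ℕ.s≤s (ℕ.s≤s ())))) _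

  isEven-residue : ∀ q r → isEven (+ ⟦ r ⟧ʳ + q * + 4) ≡ evenʳ r
  isEven-residue q ʳ0 = cong (λ n → does (n ℕ.≟ 0)) (mod2≡ (q * + 2) 0 ℕ.z<s (l q))
    where
    l : ∀ q → + 0 + q * + 4 ≡ + 0 + (q * + 2) * + 2
    l = solve-∀
  isEven-residue q ʳ1 = cong (λ n → does (n ℕ.≟ 0)) (mod2≡ (q * + 2) 1 (ℕ.s<s ℕ.z<s) (l q))
    where
    l : ∀ q → + 1 + q * + 4 ≡ + 1 + (q * + 2) * + 2
    l = solve-∀
  isEven-residue q ʳ2 = cong (λ n → does (n ℕ.≟ 0)) (mod2≡ (q * + 2 + + 1) 0 ℕ.z<s (l q))
    where
    l : ∀ q → + 2 + q * + 4 ≡ + 0 + (q * + 2 + + 1) * + 2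
    l = solve-∀
  isEven-residue q ʳ3 = cong (λ n → does (n ℕ.≟ 0)) (mod2≡ (q * + 2 + + 1) 1 (ℕ.s<s ℕ.z<s) (l q))
    where
    l : ∀ q → + 3 + q * + 4 ≡ + 1 + (q * + 2 + + 1) * + 2
    l = solve-∀

  oddRes : Bool → Residue
  oddRes true  = ʳ1
  oddRes false = ʳ3

  data Shape (w : P3) : Set where
    old : ∀ u δ → w ≡ imageHalf u δ → Shape w
    new : ∀ b → NewEdge w b → Shape w

  private
    halfRes : Tri → Residue
    halfRes t⁻ = ʳ3
    halfRes t⁰ = ʳ2
    halfRes t⁺ = ʳ1

    half-residue : ∀ t q → + ⟦ halfRes t ⟧ʳ + q * + 4 ≡ - + 4 * (- q - + 1) - ⟦ t ⟧ - + 2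
    half-residue t⁻ = solve-∀
    half-residue t⁰ = solve-∀
    half-residue t⁺ = solve-∀


    odd-residue : ∀ b q → + ⟦ oddRes b ⟧ʳ + q * + 4 ≡ + 4 * (q + bit b) + (+ 1 - + 2 * bit b)
    odd-residue true  = solve-∀
    odd-residue false = solve-∀

    even-residue : ∀ q → + 0 + q * + 4 ≡ + 4 * q
    even-residue = solve-∀

    old-shape : ∀ δ q₁ q₂ q₃ →
      Shape ⟨ + ⟦ halfRes (dir₁ δ) ⟧ʳ + q₁ * + 4 , + ⟦ halfRes (dir₂ δ) ⟧ʳ + q₂ * + 4 , + ⟦ halfRes (dir₃ δ) ⟧ʳ + q₃ * + 4 ⟩
    old-shape δ q₁ q₂ q₃ = old ⟨ - q₁ - + 1 , - q₂ - + 1 , - q₃ - + 1 ⟩ δ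
      (P3-ext (half-residue (dir₁ δ) q₁) (half-residue (dir₂ δ) q₂) (half-residue (dir₃ δ) q₃))

    new-shape₁ : ∀ b q₁ q₂ q₃ → Shape ⟨ + 0 + q₁ * + 4 , + ⟦ oddRes b ⟧ʳ + q₂ * + 4 , + ⟦ oddRes b ⟧ʳ + q₃ * + 4 ⟩
    new-shape₁ b q₁ q₂ q₃ = new b (newEdge axis₁ q₁ (q₂ + bit b) (q₃ + bit b)
      (P3-ext (even-residue q₁) (odd-residue b q₂) (odd-residue b q₃)))

    new-shape₂ : ∀ b q₁ q₂ q₃ → Shape ⟨ + ⟦ oddRes b ⟧ʳ + q₁ * + 4 , + 0 + q₂ * + 4 , + ⟦ oddRes b ⟧ʳ + q₃ * + 4 ⟩
    new-shape₂ b q₁ q₂ q₃ = new b (newEdge axis₂ q₂ (q₁ + bit b) (q₃ + bit b)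
      (P3-ext (odd-residue b q₁) (even-residue q₂) (odd-residue b q₃)))

    new-shape₃ : ∀ b q₁ q₂ q₃ → Shape ⟨ + ⟦ oddRes b ⟧ʳ + q₁ * + 4 , + ⟦ oddRes b ⟧ʳ + q₂ * + 4 , + 0 + q₃ * + 4 ⟩
    new-shape₃ b q₁ q₂ q₃ = new b (newEdge axis₃ q₃ (q₁ + bit b) (q₂ + bit b)
      (P3-ext (odd-residue b q₁) (odd-residue b q₂) (even-residue q₃)))

  -- Exactly one coordinate is even and the sum is ≡ 2 (mod 4): the even coordinate
  -- is ≡ 2 (a half of a doubled edge) or ≡ 0 (a new edge) mod 4.
  shape-by-residues : ∀ r₁ r₂ r₃ q₁ q₂ q₃ →
    count (evenʳ r₁) ℕ.+ count (evenʳ r₂) ℕ.+ count (evenʳ r₃) ≡ 1 → (⟦ r₁ ⟧ʳ ℕ.+ ⟦ r₂ ⟧ʳ ℕ.+ ⟦ r₃ ⟧ʳ) ℕ.% 4 ≡ 2 →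
    Shape ⟨ + ⟦ r₁ ⟧ʳ + q₁ * + 4 , + ⟦ r₂ ⟧ʳ + q₂ * + 4 , + ⟦ r₃ ⟧ʳ + q₃ * + 4 ⟩
  shape-by-residues ʳ0 ʳ0 _  _ _ _ () _
  shape-by-residues ʳ0 ʳ1 ʳ0 _ _ _ () _
  shape-by-residues ʳ0 ʳ1 ʳ1 q₁ q₂ q₃ _ _ = new-shape₁ true q₁ q₂ q₃
  shape-by-residues ʳ0 ʳ1 ʳ2 _ _ _ () _
  shape-by-residues ʳ0 ʳ1 ʳ3 _ _ _ _ ()
  shape-by-residues ʳ0 ʳ2 _  _ _ _ () _
  shape-by-residues ʳ0 ʳ3 ʳ0 _ _ _ () _
  shape-by-residues ʳ0 ʳ3 ʳ1 _ _ _ _ ()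
  shape-by-residues ʳ0 ʳ3 ʳ2 _ _ _ () _
  shape-by-residues ʳ0 ʳ3 ʳ3 q₁ q₂ q₃ _ _ = new-shape₁ false q₁ q₂ q₃
  shape-by-residues ʳ1 ʳ0 ʳ0 _ _ _ () _
  shape-by-residues ʳ1 ʳ0 ʳ1 q₁ q₂ q₃ _ _ = new-shape₂ true q₁ q₂ q₃
  shape-by-residues ʳ1 ʳ0 ʳ2 _ _ _ () _
  shape-by-residues ʳ1 ʳ0 ʳ3 _ _ _ _ ()
  shape-by-residues ʳ1 ʳ1 ʳ0 q₁ q₂ q₃ _ _ = new-shape₃ true q₁ q₂ q₃
  shape-by-residues ʳ1 ʳ1 ʳ1 _ _ _ () _
  shape-by-residues ʳ1 ʳ1 ʳ2 _ _ _ _ ()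
  shape-by-residues ʳ1 ʳ1 ʳ3 _ _ _ () _
  shape-by-residues ʳ1 ʳ2 ʳ0 _ _ _ () _
  shape-by-residues ʳ1 ʳ2 ʳ1 _ _ _ _ ()
  shape-by-residues ʳ1 ʳ2 ʳ2 _ _ _ () _
  shape-by-residues ʳ1 ʳ2 ʳ3 q₁ q₂ q₃ _ _ = old-shape along₂⁻ q₁ q₂ q₃
  shape-by-residues ʳ1 ʳ3 ʳ0 _ _ _ _ ()
  shape-by-residues ʳ1 ʳ3 ʳ1 _ _ _ () _
  shape-by-residues ʳ1 ʳ3 ʳ2 q₁ q₂ q₃ _ _ = old-shape along₃⁺ q₁ q₂ q₃
  shape-by-residues ʳ1 ʳ3 ʳ3 _ _ _ () _
  shape-by-residues ʳ2 ʳ0 _  _ _ _ () _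
  shape-by-residues ʳ2 ʳ1 ʳ0 _ _ _ () _
  shape-by-residues ʳ2 ʳ1 ʳ1 _ _ _ _ ()
  shape-by-residues ʳ2 ʳ1 ʳ2 _ _ _ () _
  shape-by-residues ʳ2 ʳ1 ʳ3 q₁ q₂ q₃ _ _ = old-shape along₁⁺ q₁ q₂ q₃
  shape-by-residues ʳ2 ʳ2 _  _ _ _ () _
  shape-by-residues ʳ2 ʳ3 ʳ0 _ _ _ () _
  shape-by-residues ʳ2 ʳ3 ʳ1 q₁ q₂ q₃ _ _ = old-shape along₁⁻ q₁ q₂ q₃
  shape-by-residues ʳ2 ʳ3 ʳ2 _ _ _ () _
  shape-by-residues ʳ2 ʳ3 ʳ3 _ _ _ _ ()
  shape-by-residues ʳ3 ʳ0 ʳ0 _ _ _ () _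
  shape-by-residues ʳ3 ʳ0 ʳ1 _ _ _ _ ()
  shape-by-residues ʳ3 ʳ0 ʳ2 _ _ _ () _
  shape-by-residues ʳ3 ʳ0 ʳ3 q₁ q₂ q₃ _ _ = new-shape₂ false q₁ q₂ q₃
  shape-by-residues ʳ3 ʳ1 ʳ0 _ _ _ _ ()
  shape-by-residues ʳ3 ʳ1 ʳ1 _ _ _ () _
  shape-by-residues ʳ3 ʳ1 ʳ2 q₁ q₂ q₃ _ _ = old-shape along₃⁻ q₁ q₂ q₃
  shape-by-residues ʳ3 ʳ1 ʳ3 _ _ _ () _
  shape-by-residues ʳ3 ʳ2 ʳ0 _ _ _ () _
  shape-by-residues ʳ3 ʳ2 ʳ1 q₁ q₂ q₃ _ _ = old-shape along₂⁺ q₁ q₂ q₃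
  shape-by-residues ʳ3 ʳ2 ʳ2 _ _ _ () _
  shape-by-residues ʳ3 ʳ2 ʳ3 _ _ _ _ ()
  shape-by-residues ʳ3 ʳ3 ʳ0 q₁ q₂ q₃ _ _ = new-shape₃ false q₁ q₂ q₃
  shape-by-residues ʳ3 ʳ3 ʳ1 _ _ _ () _
  shape-by-residues ʳ3 ʳ3 ʳ2 _ _ _ _ ()
  shape-by-residues ʳ3 ʳ3 ʳ3 _ _ _ () _

  private
    sum-residue : ∀ R Q → + R + Q * + 4 ≡ - + 2 → R ℕ.% 4 ≡ 2
    sum-residue R Q eq = begin
      R ℕ.% 4                                      ≡⟨ [r+q*d]%ℕd≡r 4 (+ (R ℕ./ 4) + Q) (R ℕ.% 4) (ℕD.m%n<n R 4) ⟨
      (+ (R ℕ.% 4) + (+ (R ℕ./ 4) + Q) * + 4) %ℕ 4 ≡⟨ cong (_%ℕ 4) (trans split eq) ⟩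
      2                                            ∎
      where
      open ≡-Reasoning
      l : ∀ r k q → r + (k + q) * + 4 ≡ r + k * + 4 + q * + 4
      l = solve-∀
      split : + (R ℕ.% 4) + (+ (R ℕ./ 4) + Q) * + 4 ≡ + R + Q * + 4
      split = begin
        + (R ℕ.% 4) + (+ (R ℕ./ 4) + Q) * + 4         ≡⟨ l (+ (R ℕ.% 4)) (+ (R ℕ./ 4)) Q ⟩
        + (R ℕ.% 4) + + (R ℕ./ 4) * + 4 + Q * + 4     ≡⟨ cong (λ k → + (R ℕ.% 4) + k + Q * + 4) (ℤP.pos-* (R ℕ./ 4) 4) ⟨
        + (R ℕ.% 4 ℕ.+ R ℕ./ 4 ℕ.* 4) + Q * + 4       ≡⟨ cong (λ n → + n + Q * + 4) (ℕD.m≡m%n+[m/n]*n R 4) ⟨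
        + R + Q * + 4                                 ∎

  classify : ∀ w → IsEdge w → Shape w
  classify ⟨ x , y , z ⟩ (sum , evens) with mod4-view x | mod4-view y | mod4-view z
  ... | q₁ , r₁ , refl | q₂ , r₂ , refl | q₃ , r₃ , refl = shape-by-residues r₁ r₂ r₃ q₁ q₂ q₃ evens′ sum′
    where
    evens′ : count (evenʳ r₁) ℕ.+ count (evenʳ r₂) ℕ.+ count (evenʳ r₃) ≡ 1
    evens′ = trans (cong₂ ℕ._+_ (cong₂ ℕ._+_ (cong count (sym (isEven-residue q₁ r₁)))
                                            (cong count (sym (isEven-residue q₂ r₂))))
                                (cong count (sym (isEven-residue q₃ r₃)))) evens
    sum′ : (⟦ r₁ ⟧ʳ ℕ.+ ⟦ r₂ ⟧ʳ ℕ.+ ⟦ r₃ ⟧ʳ) ℕ.% 4 ≡ 2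
    sum′ = sum-residue _ (q₁ + q₂ + q₃) (trans (l (+ ⟦ r₁ ⟧ʳ) (+ ⟦ r₂ ⟧ʳ) (+ ⟦ r₃ ⟧ʳ) q₁ q₂ q₃) sum)
      where
      l : ∀ a b d q₁ q₂ q₃ → a + b + d + (q₁ + q₂ + q₃) * + 4 ≡ (a + q₁ * + 4) + (b + q₂ * + 4) + (d + q₃ * + 4)
      l = solve-∀

  private
    isT⁰ : Tri → Bool
    isT⁰ t⁰ = true
    isT⁰ _  = false

    isEven-2u+t : ∀ u t → isEven (+ 2 * u + ⟦ t ⟧) ≡ isT⁰ t
    isEven-2u+t u t⁻ = cong (λ n → does (n ℕ.≟ 0)) (mod2≡ (u - + 1) 1 (ℕ.s<s ℕ.z<s) (l u))
      where
      l : ∀ u → + 2 * u + - + 1 ≡ + 1 + (u - + 1) * + 2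
      l = solve-∀
    isEven-2u+t u t⁰ = cong (λ n → does (n ℕ.≟ 0)) (mod2≡ u 0 ℕ.z<s (l u))
      where
      l : ∀ u → + 2 * u + + 0 ≡ + 0 + u * + 2
      l = solve-∀
    isEven-2u+t u t⁺ = cong (λ n → does (n ℕ.≟ 0)) (mod2≡ u 1 (ℕ.s<s ℕ.z<s) (l u))
      where
      l : ∀ u → + 2 * u + + 1 ≡ + 1 + u * + 2
      l = solve-∀

    one-fixed-coordinate : ∀ δ → count (isT⁰ (dir₁ δ)) ℕ.+ count (isT⁰ (dir₂ δ)) ℕ.+ count (isT⁰ (dir₃ δ)) ≡ 1
    one-fixed-coordinate along₁⁺ = refl
    one-fixed-coordinate along₁⁻ = refl
    one-fixed-coordinate along₂⁺ = refl
    one-fixed-coordinate along₂⁻ = refl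
    one-fixed-coordinate along₃⁺ = refl
    one-fixed-coordinate along₃⁻ = refl

  edge-isEdge : ∀ u δ → Balanced (edge u δ) → IsEdge (edge u δ)
  edge-isEdge u δ sum = sum , trans (cong₂ ℕ._+_ (cong₂ ℕ._+_ (cong count (isEven-2u+t (c₁ u) (dir₁ δ)))
                                                              (cong count (isEven-2u+t (c₂ u) (dir₂ δ))))
                                                  (cong count (isEven-2u+t (c₃ u) (dir₃ δ))))
                                    (one-fixed-coordinate δ)

  -- Local coordinates

  _HasResidue_ : ℤ → Residue → Set
  x HasResidue r = ∃ λ k → x ≡ + ⟦ r ⟧ʳ + k * + 4

  residue≡ : ∀ {x r} → x HasResidue r → x %ℕ 4 ≡ ⟦ r ⟧ʳ
  residue≡ {r = r} (k , refl) = [r+q*d]%ℕd≡r 4 k ⟦ r ⟧ʳ (residue<4 r)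

  halfOfOldEdge-residues : ∀ X r₁ r₂ r₃ → c₁ X HasResidue r₁ → c₂ X HasResidue r₂ → c₃ X HasResidue r₃ →
    halfOfOldEdge X ≡ (does (⟦ r₁ ⟧ʳ ℕ.≟ 0) ∨ does (⟦ r₂ ⟧ʳ ℕ.≟ 0) ∨ does (⟦ r₃ ⟧ʳ ℕ.≟ 0))
  halfOfOldEdge-residues X r₁ r₂ r₃ h₁ h₂ h₃ =
    cong₂ _∨_ (cong is0 (residue≡ h₁)) (cong₂ _∨_ (cong is0 (residue≡ h₂)) (cong is0 (residue≡ h₃)))
    where
    is0 : ℕ → Bool
    is0 n = does (n ℕ.≟ 0)

  inPositiveτ-residues : ∀ X r₁ r₂ r₃ → c₁ X HasResidue r₁ → c₂ X HasResidue r₂ → c₃ X HasResidue r₃ →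
    inPositiveτ X ≡ (does (⟦ r₁ ⟧ʳ ℕ.≟ 1) ∨ does (⟦ r₂ ⟧ʳ ℕ.≟ 1) ∨ does (⟦ r₃ ⟧ʳ ℕ.≟ 1))
  inPositiveτ-residues X r₁ r₂ r₃ h₁ h₂ h₃ =
    cong₂ _∨_ (cong is1 (residue≡ h₁)) (cong₂ _∨_ (cong is1 (residue≡ h₂)) (cong is1 (residue≡ h₃)))
    where
    is1 : ℕ → Bool
    is1 n = does (n ℕ.≟ 1)

  evenᵇ : ℕ → Bool
  evenᵇ zero    = true
  evenᵇ (suc n) = not (evenᵇ n)

  -- The coordinates d_i of the text for the triangle with sides on the lines u_i = c when
  -- it is positive (E); otherwise those of its image under x ↦ -x.
  localCoord : Bool → ℤ → ℤ → ℤ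
  localCoord true  c x = + 2 * c - x
  localCoord false c x = x - + 2 * c

  localAt : Bool → ℤ → P3 → P3
  localAt E c w = ⟨ localCoord E c (c₁ w) , localCoord E c (c₂ w) , localCoord E c (c₃ w) ⟩

  -- (-2)ⁿ T₀ is positive exactly when n is even
  local : ℕ → P3 → P3
  local n = localAt (evenᵇ n) (foldLine n)

  private
    even-coord : ∀ E h p → localCoord E (+ 2 * h + + 1) (+ 4 * p) HasResidue ʳ2
    even-coord true  h p = h - p , l h p
      where
      l : ∀ h p → + 2 * (+ 2 * h + + 1) - + 4 * p ≡ + 2 + (h - p) * + 4
      l = solve-∀
    even-coord false h p = p - h - + 1 , l h p
      where
      l : ∀ h p → + 4 * p - + 2 * (+ 2 * h + + 1) ≡ + 2 + (p - h - + 1) * + 4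
      l = solve-∀

    odd-coord : ∀ E h q b → localCoord E (+ 2 * h + + 1) (+ 4 * q + (+ 1 - + 2 * bit b)) HasResidue oddRes (if E then b else not b)
    odd-coord true  h q true  = h - q , l h q
      where
      l : ∀ h q → + 2 * (+ 2 * h + + 1) - (+ 4 * q + (+ 1 - + 2 * + 0)) ≡ + 1 + (h - q) * + 4
      l = solve-∀
    odd-coord true  h q false = h - q , l h q
      where
      l : ∀ h q → + 2 * (+ 2 * h + + 1) - (+ 4 * q + (+ 1 - + 2 * + 1)) ≡ + 3 + (h - q) * + 4
      l = solve-∀
    odd-coord false h q true  = q - h - + 1 , l h q
      where
      l : ∀ h q → + 4 * q + (+ 1 - + 2 * + 0) - + 2 * (+ 2 * h + + 1) ≡ + 3 + (q - h - + 1) * + 4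
      l = solve-∀
    odd-coord false h q false = q - h - + 1 , l h q
      where
      l : ∀ h q → + 4 * q + (+ 1 - + 2 * + 1) - + 2 * (+ 2 * h + + 1) ≡ + 1 + (q - h - + 1) * + 4
      l = solve-∀

    oddRes≢0 : ∀ b → does (⟦ oddRes b ⟧ʳ ℕ.≟ 0) ≡ false
    oddRes≢0 true  = refl
    oddRes≢0 false = refl

    oddRes≡1 : ∀ b → does (⟦ oddRes b ⟧ʳ ℕ.≟ 1) ≡ b
    oddRes≡1 true  = refl
    oddRes≡1 false = refl

  localAt-newEdge : ∀ E h w b → NewEdge w b → let X = localAt E (+ 2 * h + + 1) w in
    halfOfOldEdge X ≡ false × inPositiveτ X ≡ (if E then b else not b)
  localAt-newEdge E h w b (newEdge i p q s eq) =
    subst (λ x → halfOfOldEdge (localAt E c x) ≡ false × inPositiveτ (localAt E c x) ≡ b′) (sym eq) (by-axis i)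
    where
    c = + 2 * h + + 1
    b′ = if E then b else not b
    ev = even-coord E h p
    oq = odd-coord E h q b
    os = odd-coord E h s b
    r = oddRes b′
    by-axis : ∀ i → halfOfOldEdge (localAt E c (newCode i b p q s)) ≡ false × inPositiveτ (localAt E c (newCode i b p q s)) ≡ b′
    by-axis axis₁ =
      trans (halfOfOldEdge-residues _ ʳ2 r r ev oq os) (∨₃-false refl (oddRes≢0 b′) (oddRes≢0 b′)) ,
      trans (inPositiveτ-residues _ ʳ2 r r ev oq os) (trans (cong₂ _∨_ (oddRes≡1 b′) (oddRes≡1 b′)) (∨-idem b′))
    by-axis axis₂ =
      trans (halfOfOldEdge-residues _ r ʳ2 r oq ev os) (∨₃-false (oddRes≢0 b′) refl (oddRes≢0 b′)) ,
      trans (inPositiveτ-residues _ r ʳ2 r oq ev os) (trans (cong₂ _∨_ (oddRes≡1 b′) (oddRes≡1 b′)) (∨-idem b′))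
    by-axis axis₃ =
      trans (halfOfOldEdge-residues _ r r ʳ2 oq os ev) (∨₃-false (oddRes≢0 b′) (oddRes≢0 b′) refl) ,
      trans (inPositiveτ-residues _ r r ʳ2 oq os ev) (trans (cong₂ _∨_ (oddRes≡1 b′) (trans (cong (_∨ false) (oddRes≡1 b′)) (∨-identityʳ b′))) (∨-idem b′))

  quarterRes : Tri → Residue
  quarterRes t⁻ = ʳ3
  quarterRes t⁰ = ʳ0
  quarterRes t⁺ = ʳ1

  private
    quarter-residue : ∀ Q t → (+ 4 * Q + ⟦ t ⟧) HasResidue quarterRes t
    quarter-residue Q t⁻ = Q - + 1 , l Q
      where
      l : ∀ Q → + 4 * Q + - + 1 ≡ + 3 + (Q - + 1) * + 4
      l = solve-∀
    quarter-residue Q t⁰ = Q , l Q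
      where
      l : ∀ Q → + 4 * Q + + 0 ≡ + 0 + Q * + 4
      l = solve-∀
    quarter-residue Q t⁺ = Q , l Q
      where
      l : ∀ Q → + 4 * Q + + 1 ≡ + 1 + Q * + 4
      l = solve-∀

    quarter-quotient : ∀ Q t → (+ 4 * Q + ⟦ t ⟧ + + 1) /ℕ 4 ≡ Q
    quarter-quotient Q t⁻ = trans (cong (_/ℕ 4) (l Q)) ([r+q*d]/ℕd≡q 4 Q 0 (residue<4 ʳ0))
      where
      l : ∀ Q → + 4 * Q + - + 1 + + 1 ≡ + 0 + Q * + 4
      l = solve-∀
    quarter-quotient Q t⁰ = trans (cong (_/ℕ 4) (l Q)) ([r+q*d]/ℕd≡q 4 Q 1 (residue<4 ʳ1))
      where
      l : ∀ Q → + 4 * Q + + 0 + + 1 ≡ + 1 + Q * + 4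
      l = solve-∀
    quarter-quotient Q t⁺ = trans (cong (_/ℕ 4) (l Q)) ([r+q*d]/ℕd≡q 4 Q 2 (residue<4 ʳ2))
      where
      l : ∀ Q → + 4 * Q + + 1 + + 1 ≡ + 2 + Q * + 4
      l = solve-∀

    oldCoord-quarter : ∀ Q t → let x = + 4 * Q + ⟦ t ⟧ in x - + 2 * ((x + + 1) /ℕ 4) ≡ + 2 * Q + ⟦ t ⟧
    oldCoord-quarter Q t = trans (cong (λ k → + 4 * Q + ⟦ t ⟧ - + 2 * k) (quarter-quotient Q t)) (l Q ⟦ t ⟧)
      where
      l : ∀ Q d → + 4 * Q + d - + 2 * Q ≡ + 2 * Q + d
      l = solve-∀

    some-coordinate-fixed : ∀ δ → (does (⟦ quarterRes (dir₁ δ) ⟧ʳ ℕ.≟ 0) ∨ does (⟦ quarterRes (dir₂ δ) ⟧ʳ ℕ.≟ 0)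
                                    ∨ does (⟦ quarterRes (dir₃ δ) ⟧ʳ ℕ.≟ 0)) ≡ true
    some-coordinate-fixed along₁⁺ = refl
    some-coordinate-fixed along₁⁻ = refl
    some-coordinate-fixed along₂⁺ = refl
    some-coordinate-fixed along₂⁻ = refl
    some-coordinate-fixed along₃⁺ = refl
    some-coordinate-fixed along₃⁻ = refl

  -- in local coordinates, the half at 2Q of the double of the edge from Q to Q + δ
  quarter : P3 → Dir → P3
  quarter Q δ = ⟨ + 4 * c₁ Q + ⟦ dir₁ δ ⟧ , + 4 * c₂ Q + ⟦ dir₂ δ ⟧ , + 4 * c₃ Q + ⟦ dir₃ δ ⟧ ⟩

  halfOfOldEdge-quarter : ∀ Q δ → halfOfOldEdge (quarter Q δ) ≡ true × oldEdge (quarter Q δ) ≡ edge Q δ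
  halfOfOldEdge-quarter Q δ =
    trans (halfOfOldEdge-residues (quarter Q δ) _ _ _ (quarter-residue (c₁ Q) (dir₁ δ))
            (quarter-residue (c₂ Q) (dir₂ δ)) (quarter-residue (c₃ Q) (dir₃ δ))) (some-coordinate-fixed δ) ,
    P3-ext (oldCoord-quarter (c₁ Q) (dir₁ δ)) (oldCoord-quarter (c₂ Q) (dir₂ δ)) (oldCoord-quarter (c₃ Q) (dir₃ δ))

  negDir : Dir → Dir
  negDir along₁⁺ = along₁⁻
  negDir along₁⁻ = along₁⁺
  negDir along₂⁺ = along₂⁻
  negDir along₂⁻ = along₂⁺
  negDir along₃⁺ = along₃⁻
  negDir along₃⁻ = along₃⁺

  vec-negDir : ∀ δ → vec (negDir δ) ≡ ⟨ - ⟦ dir₁ δ ⟧ , - ⟦ dir₂ δ ⟧ , - ⟦ dir₃ δ ⟧ ⟩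
  vec-negDir along₁⁺ = refl
  vec-negDir along₁⁻ = refl
  vec-negDir along₂⁺ = refl
  vec-negDir along₂⁻ = refl
  vec-negDir along₃⁺ = refl
  vec-negDir along₃⁻ = refl

  private
    half-even : ∀ c u t → (- + 4 * u - t - + 2) - + 2 * (- + 2 * c - + 1) ≡ + 4 * (c - u) + - t
    half-even = solve-∀
    edge-even : ∀ c u t → + 2 * c - (+ 2 * u + t) ≡ + 2 * (c - u) + - t
    edge-even = solve-∀
    half-odd : ∀ c u t → + 2 * (- + 2 * c - + 1) - (- + 4 * u - t - + 2) ≡ + 4 * (u - c) + t
    half-odd = solve-∀
    edge-odd : ∀ c u t → + 2 * u + t - + 2 * c ≡ + 2 * (u - c) + t
    edge-odd = solve-∀

  localAt-imageHalf : ∀ E c u δ → let X = localAt (not E) (- + 2 * c - + 1) (imageHalf u δ) in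
                       halfOfOldEdge X ≡ true × oldEdge X ≡ localAt E c (edge u δ)
  localAt-imageHalf true c u δ =
    subst (λ X → halfOfOldEdge X ≡ true × oldEdge X ≡ localAt true c (edge u δ)) (sym X≡)
      (proj₁ q , trans (proj₂ q) (sym e≡))
    where
    Q = ⟨ c - c₁ u , c - c₂ u , c - c₃ u ⟩
    q = halfOfOldEdge-quarter Q (negDir δ)
    n₁ = cong c₁ (sym (vec-negDir δ))
    n₂ = cong c₂ (sym (vec-negDir δ))
    n₃ = cong c₃ (sym (vec-negDir δ))
    X≡ : localAt false (- + 2 * c - + 1) (imageHalf u δ) ≡ quarter Q (negDir δ)
    X≡ = P3-ext (trans (half-even c (c₁ u) ⟦ dir₁ δ ⟧) (cong (λ d → + 4 * (c - c₁ u) + d) n₁))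
                (trans (half-even c (c₂ u) ⟦ dir₂ δ ⟧) (cong (λ d → + 4 * (c - c₂ u) + d) n₂))
                (trans (half-even c (c₃ u) ⟦ dir₃ δ ⟧) (cong (λ d → + 4 * (c - c₃ u) + d) n₃))
    e≡ : localAt true c (edge u δ) ≡ edge Q (negDir δ)
    e≡ = P3-ext (trans (edge-even c (c₁ u) ⟦ dir₁ δ ⟧) (cong (λ d → + 2 * (c - c₁ u) + d) n₁))
                (trans (edge-even c (c₂ u) ⟦ dir₂ δ ⟧) (cong (λ d → + 2 * (c - c₂ u) + d) n₂))
                (trans (edge-even c (c₃ u) ⟦ dir₃ δ ⟧) (cong (λ d → + 2 * (c - c₃ u) + d) n₃))
  localAt-imageHalf false c u δ =
    subst (λ X → halfOfOldEdge X ≡ true × oldEdge X ≡ localAt false c (edge u δ)) (sym X≡)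
      (proj₁ q , trans (proj₂ q) (sym e≡))
    where
    Q = ⟨ c₁ u - c , c₂ u - c , c₃ u - c ⟩
    q = halfOfOldEdge-quarter Q δ
    X≡ : localAt true (- + 2 * c - + 1) (imageHalf u δ) ≡ quarter Q δ
    X≡ = P3-ext (half-odd c (c₁ u) ⟦ dir₁ δ ⟧) (half-odd c (c₂ u) ⟦ dir₂ δ ⟧) (half-odd c (c₃ u) ⟦ dir₃ δ ⟧)
    e≡ : localAt false c (edge u δ) ≡ edge Q δ
    e≡ = P3-ext (edge-odd c (c₁ u) ⟦ dir₁ δ ⟧) (edge-odd c (c₂ u) ⟦ dir₂ δ ⟧) (edge-odd c (c₃ u) ⟦ dir₃ δ ⟧)

  -- The substitutions

  flipIf : Bool → Colour → Colour
  flipIf true  = opposite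
  flipIf false = id

  Fchain : (ℕ → Sign) → ℕ → Colouring → Colouring
  Fchain a zero    col = col
  Fchain a (suc n) col = F (a 1) (Fchain (a ∘ suc) n col)

  F-half : ∀ ε col X → halfOfOldEdge X ≡ true → F ε col X ≡ opposite (col (oldEdge X))
  F-half ε col X h = cong (λ b → if b then opposite (col (oldEdge X)) else interiorColour ε (inPositiveτ X)) h

  F-interior : ∀ ε col X → halfOfOldEdge X ≡ false → F ε col X ≡ interiorColour ε (inPositiveτ X)
  F-interior ε col X h = cong (λ b → if b then opposite (col (oldEdge X)) else interiorColour ε (inPositiveτ X)) h

  opposite-involutive : ∀ x → opposite (opposite x) ≡ x
  opposite-involutive red  = refl
  opposite-involutive blue = refl

  flipIf-opposite : ∀ E x → flipIf (not E) x ≡ flipIf (not (not E)) (opposite x)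
  flipIf-opposite true  x = sym (opposite-involutive x)
  flipIf-opposite false x = refl

  -- interiorColour and creaseColour are the same table.
  creaseColour≡interiorColour : ∀ E ε b → creaseColour ε b ≡ flipIf (not E) (interiorColour ε (if E then b else not b))
  creaseColour≡interiorColour true  plus  true  = refl
  creaseColour≡interiorColour true  plus  false = refl
  creaseColour≡interiorColour true  minus true  = refl
  creaseColour≡interiorColour true  minus false = refl
  creaseColour≡interiorColour false plus  true  = refl
  creaseColour≡interiorColour false plus  false = refl
  creaseColour≡interiorColour false minus true  = refl
  creaseColour≡interiorColour false minus false = refl

  local-imageHalf : ∀ n u δ → halfOfOldEdge (local (suc n) (imageHalf u δ)) ≡ true
                             × oldEdge (local (suc n) (imageHalf u δ)) ≡ local n (edge u δ)
  local-imageHalf n u δ =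
    subst (λ c → halfOfOldEdge (localAt (not (evenᵇ n)) c (imageHalf u δ)) ≡ true
               × oldEdge (localAt (not (evenᵇ n)) c (imageHalf u δ)) ≡ local n (edge u δ))
          (sym (foldLine-suc n)) (localAt-imageHalf (evenᵇ n) (foldLine n) u δ)

  local-newEdge : ∀ n w b → NewEdge w b → halfOfOldEdge (local (suc n) w) ≡ false
                  × inPositiveτ (local (suc n) w) ≡ (if evenᵇ (suc n) then b else not b)
  local-newEdge n w b nw =
    subst (λ c → halfOfOldEdge (localAt (evenᵇ (suc n)) c w) ≡ false
               × inPositiveτ (localAt (evenᵇ (suc n)) c w) ≡ (if evenᵇ (suc n) then b else not b))
          (sym (foldLine-odd n)) (localAt-newEdge (evenᵇ (suc n)) (- foldLine n - + 1) w b nw)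

  -- Any colouring col of the seed will do: no edge is interior to T₀.
  foldColour≡Fchain : ∀ n a col w → IsEdge w → InteriorTo (μ (suc n)) w →
                      foldColour a n w false ≡ flipIf (not (evenᵇ n)) (Fchain a n col (local n w))
  foldColour≡Fchain zero    a col w (sum , _) int = contradiction int (noEdgeInside-T₀ w sum)
  foldColour≡Fchain (suc n) a col w is-edge@(sum , _) int = by-shape (classify w is-edge)
    where
    open ≡-Reasoning
    by-shape : Shape w → foldColour a (suc n) w false ≡ flipIf (not (evenᵇ (suc n))) (Fchain a (suc n) col (local (suc n) w))
    by-shape (old u δ refl) = begin
      foldColour a (suc n) h false
        ≡⟨ foldColour-imageHalf a n u δ false sum int ⟩
      foldColour (a ∘ suc) n e false
        ≡⟨ foldColour≡Fchain n (a ∘ suc) col e e-isEdge (interior-imageHalf⇒edge n u δ int) ⟩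
      flipIf (not (evenᵇ n)) (Fchain (a ∘ suc) n col (local n e))
        ≡⟨ flipIf-opposite (evenᵇ n) _ ⟩
      flipIf (not (evenᵇ (suc n))) (opposite (Fchain (a ∘ suc) n col (local n e)))
        ≡⟨ cong (λ X → flipIf (not (evenᵇ (suc n))) (opposite (Fchain (a ∘ suc) n col X))) (proj₂ (local-imageHalf n u δ)) ⟨
      flipIf (not (evenᵇ (suc n))) (opposite (Fchain (a ∘ suc) n col (oldEdge (local (suc n) h))))
        ≡⟨ cong (flipIf (not (evenᵇ (suc n)))) (F-half (a 1) (Fchain (a ∘ suc) n col) (local (suc n) h) (proj₁ (local-imageHalf n u δ))) ⟨
      flipIf (not (evenᵇ (suc n))) (Fchain a (suc n) col (local (suc n) h)) ∎
      where
      h = imageHalf u δ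
      e = edge u δ
      e-isEdge : IsEdge e
      e-isEdge = edge-isEdge u δ (balanced-imageHalf⇒edge u δ sum)
    by-shape (new b nw) = begin
      foldColour a (suc n) w false
        ≡⟨ foldColour-newEdge a n w b false nw sum int ⟩
      creaseColour (a 1) b
        ≡⟨ creaseColour≡interiorColour (evenᵇ (suc n)) (a 1) b ⟩
      flipIf (not (evenᵇ (suc n))) (interiorColour (a 1) (if evenᵇ (suc n) then b else not b))
        ≡⟨ cong (λ p → flipIf (not (evenᵇ (suc n))) (interiorColour (a 1) p)) (proj₂ (local-newEdge n w b nw)) ⟨
      flipIf (not (evenᵇ (suc n))) (interiorColour (a 1) (inPositiveτ (local (suc n) w)))
        ≡⟨ cong (flipIf (not (evenᵇ (suc n)))) (F-interior (a 1) (Fchain (a ∘ suc) n col) (local (suc n) w) (proj₁ (local-newEdge n w b nw))) ⟨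
      flipIf (not (evenᵇ (suc n))) (Fchain a (suc n) col (local (suc n) w)) ∎

  F-cong : ∀ ε {col col′} → col ≗ col′ → F ε col ≗ F ε col′
  F-cong ε eq X = cong (λ c → if halfOfOldEdge X then opposite c else interiorColour ε (inPositiveτ X)) (eq (oldEdge X))

  Gsub-cong : ∀ a k {col col′} → col ≗ col′ → Gsub a k col ≗ Gsub a k col′
  Gsub-cong a zero    eq = eq
  Gsub-cong a (suc k) eq = Gsub-cong a k (F-cong (a (suc k)) eq)

  Fchain-cong : ∀ {a b} n col → (∀ i → a (suc i) ≡ b (suc i)) → Fchain a n col ≗ Fchain b n col
  Fchain-cong zero    col eq X = refl
  Fchain-cong {a} {b} (suc n) col eq X =
    trans (cong (λ ε → F ε (Fchain (a ∘ suc) n col) X) (eq 0))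
          (F-cong (b 1) (Fchain-cong n col (eq ∘ suc)) X)

  Gsub-Fchain : ∀ a k n col → Gsub a k (Fchain (λ i → a (k ℕ.+ i)) n col) ≗ Fchain a (k ℕ.+ n) col
  Gsub-Fchain a zero    n col X = refl
  Gsub-Fchain a (suc k) n col X = begin
    Gsub a k (F (a (suc k)) (Fchain (λ i → a (suc k ℕ.+ i)) n col)) X
      ≡⟨ Gsub-cong a k step X ⟩
    Gsub a k (Fchain (λ i → a (k ℕ.+ i)) (suc n) col) X
      ≡⟨ Gsub-Fchain a k (suc n) col X ⟩
    Fchain a (k ℕ.+ suc n) col X
      ≡⟨ cong (λ m → Fchain a m col X) (ℕP.+-suc k n) ⟩
    Fchain a (suc k ℕ.+ n) col X ∎
    where
    open ≡-Reasoning
    step : F (a (suc k)) (Fchain (λ i → a (suc k ℕ.+ i)) n col) ≗ Fchain (λ i → a (k ℕ.+ i)) (suc n) col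
    step Y = trans (cong (λ ε → F ε (Fchain (λ i → a (suc k ℕ.+ i)) n col) Y) (cong a (ℕP.+-comm 1 k)))
                   (F-cong (a (k ℕ.+ 1)) (Fchain-cong {λ i → a (suc k ℕ.+ i)} {λ i → a (k ℕ.+ suc i)} n col
                     (λ i → cong a (sym (ℕP.+-suc k (suc i))))) Y)

  iterate-Gsub : ∀ a k n col → (∀ i → a (suc i ℕ.+ k) ≡ a (suc i)) → iterate n (Gsub a k) col ≗ Fchain a (k ℕ.* n) col
  iterate-Gsub a k zero    col per X = cong (λ m → Fchain a m col X) (sym (ℕP.*-zeroʳ k))
  iterate-Gsub a k (suc n) col per X = begin
    Gsub a k (iterate n (Gsub a k) col) X               ≡⟨ Gsub-cong a k (iterate-Gsub a k n col per) X ⟩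
    Gsub a k (Fchain a (k ℕ.* n) col) X                  ≡⟨ Gsub-cong a k (Fchain-cong (k ℕ.* n) col periodic) X ⟩
    Gsub a k (Fchain (λ i → a (k ℕ.+ i)) (k ℕ.* n) col) X ≡⟨ Gsub-Fchain a k (k ℕ.* n) col X ⟩
    Fchain a (k ℕ.+ k ℕ.* n) col X                       ≡⟨ cong (λ m → Fchain a m col X) (ℕP.*-suc k n) ⟨
    Fchain a (k ℕ.* suc n) col X                         ∎
    where
    open ≡-Reasoning
    periodic : ∀ i → a (suc i) ≡ a (k ℕ.+ suc i)
    periodic i = trans (sym (per i)) (cong a (ℕP.+-comm (suc i) k))

  even-multiple : ∀ k n → 2 ∣ k → evenᵇ (k ℕ.* n) ≡ true
  even-multiple k n (divides q k≡q*2) = trans (cong evenᵇ kn≡) (evenᵇ-*2 (q ℕ.* n))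
    where
    open ≡-Reasoning
    kn≡ : k ℕ.* n ≡ q ℕ.* n ℕ.* 2
    kn≡ = begin
      k ℕ.* n          ≡⟨ cong (ℕ._* n) k≡q*2 ⟩
      q ℕ.* 2 ℕ.* n    ≡⟨ ℕP.*-assoc q 2 n ⟩
      q ℕ.* (2 ℕ.* n)  ≡⟨ cong (q ℕ.*_) (ℕP.*-comm 2 n) ⟩
      q ℕ.* (n ℕ.* 2)  ≡⟨ ℕP.*-assoc q n 2 ⟨
      q ℕ.* n ℕ.* 2    ∎
    evenᵇ-*2 : ∀ m → evenᵇ (m ℕ.* 2) ≡ true
    evenᵇ-*2 zero    = refl
    evenᵇ-*2 (suc m) = trans (not-involutive (evenᵇ (m ℕ.* 2))) (evenᵇ-*2 m)

  μ-even : ∀ N → evenᵇ N ≡ true → μ (suc N) ≡ + (2 ℕ.^ N)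
  μ-even zero          _ = refl
  μ-even (suc (suc N)) e = begin
    - + 2 * (- + 2 * μ (suc N))  ≡⟨ cong (λ y → - + 2 * (- + 2 * y)) (μ-even N (trans (sym (not-involutive (evenᵇ N))) e)) ⟩
    - + 2 * (- + 2 * + x)        ≡⟨ l (+ x) ⟩
    + 2 * (+ 2 * + x)            ≡⟨ cong (+ 2 *_) (ℤP.pos-* 2 x) ⟨
    + 2 * + (2 ℕ.* x)            ≡⟨ ℤP.pos-* 2 (2 ℕ.* x) ⟨
    + (2 ℕ.* (2 ℕ.* x))          ∎
    where
    open ≡-Reasoning
    x = 2 ℕ.^ N
    l : ∀ y → - + 2 * (- + 2 * y) ≡ + 2 * (+ 2 * y)
    l = solve-∀

open import Data.Nat using (ℕ; _+_; _*_; _^_; _≤_; _<_)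
open import Data.Nat.Divisibility using (_∣_)
open import Data.Integer using (+_; -_)
import Data.Integer as ℤ
open import Relation.Binary.PropositionalEquality using (_≡_)

open import Data.Nat using (suc; s≤s; z≤n)
open import Data.Bool using (true; false; not)
open import Data.Product using (_,_)
open import Relation.Binary.PropositionalEquality using (cong; sym; trans; subst; module ≡-Reasoning)
open Patterns

theorem5p2 : (a : ℕ → Sign) (k : ℕ) → 0 < k → 2 ∣ k
    → (∀ i → 1 ≤ i → a (i + k) ≡ a i)
    → ∀ (n : ℕ) → 1 ≤ n
    → ∀ (m : ℕ) (w : P3) → IsEdge w
    → InteriorTo (+ (2 ^ (k * n))) w
    → InteriorTo ((- + 2) ℤ.^ m) w
    → iterate n (Gsub a k) (seed a) (toLocal (+ (2 ^ (k * n))) w) ≡ foldPattern a m w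
theorem5p2 a k _ 2∣k periodic n _ m w is-edge@(sum , _) int-kn int-m = begin
  iterate n (Gsub a k) (seed a) (toLocal (+ (2 ^ N)) w)
    ≡⟨ iterate-Gsub a k n (seed a) (λ i → periodic (suc i) (s≤s z≤n)) _ ⟩
  Fchain a N (seed a) (toLocal (+ (2 ^ N)) w)
    ≡⟨ cong (Fchain a N (seed a)) toLocal≡local ⟩
  Fchain a N (seed a) (local N w)
    ≡⟨ cong (λ E → flipIf (not E) (Fchain a N (seed a) (local N w))) N-even ⟨
  flipIf (not (evenᵇ N)) (Fchain a N (seed a) (local N w))
    ≡⟨ foldColour≡Fchain N a (seed a) w is-edge int-N ⟨
  foldColour a N w false
    ≡⟨ foldPattern≡foldColour a N w sum int-N ⟨
  foldPattern a N w
    ≡⟨ foldPattern-independent a N m w sum int-N int-m ⟩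
  foldPattern a m w ∎
  where
  open ≡-Reasoning
  N = k * n
  N-even : evenᵇ N ≡ true
  N-even = even-multiple k n 2∣k
  int-N : InteriorTo (μ (suc N)) w
  int-N = subst (λ s → InteriorTo s w) (sym (μ-even N N-even)) int-kn
  toLocal≡local : toLocal (+ (2 ^ N)) w ≡ local N w
  toLocal≡local = trans (cong (λ s → toLocal s w) (sym (μ-even N N-even)))
                        (cong (λ E → localAt E (foldLine N) w) (sym N-even))
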